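{- Let $g\ge1$, let $C\subseteq\mathbb{F}_2^n$ be a Type II code and let $T\subseteq[n]$. Then the genus-$g$ Jacobi polynomial $J_{C,T}^{(g)}$ is invariant under the action of the group $G_g\subseteq\mathrm{GL}(2^{g+1},\mathbb{C})$, i.e. $\tau J_{C,T}^{(g)}=J_{C,T}^{(g)}$ for all $\tau\in G_g$.
   Context: A binary linear code $C\subseteq\mathbb{F}_2^n$ is Type II if $C=C^\perp$ (dual with respect to the standard inner product) and every codeword has weight divisible by $4$. $[n]=\{1,\dots,n\}$. For $u_1,\dots,u_g\in C$, $a\in\mathbb{F}_2^g$ and $X\subseteq[n]$, let $n_{a,X}(u_1,\dots,u_g)$ be the number of $i\in X$ with $(u_{1i},\dots,u_{gi})=a$. The genus-$g$ Jacobi polynomial is \[J_{C,T}^{(g)}=\sum_{u_1,\dots,u_g\in C}\prod_{a\in\mathbb{F}_2^g}y_a^{n_{a,T}(u_1,\dots,u_g)}x_a^{n_{a,[n]\setminus T}(u_1,\dots,u_g)}.\] A matrix $\tau\in\mathrm{GL}(2^{g+1},\mathbb{C})$ acts on polynomials $f$ in the $2^{g+1}$ variables arranged as the column vector $v=((x_a)_{a\in\mathbb{F}_2^g},(y_a)_{a\in\mathbb{F}_2^g})$ (each block indexed by $\mathbb{F}_2^g$ in lexicographic order) by $(\tau f)(v)=f(\tau v)$. Define $2^g\times2^g$ matrices $T_g=\left(\frac{1+i}{2}\right)^g\big((-1)^{a\cdot b}\big)_{a,b\in\mathbb{F}_2^g}$ and $E_g=\mathrm{diag}(1,i,1,i,\dots)$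 (the diagonal entry at $a=(a_1,\dots,a_g)$ being $i^{a_g}$). For $\sigma=(w,M)\in\mathbb{F}_2^g\rtimes\mathrm{GL}(g,\mathbb{F}_2)$ acting on $\mathbb{F}_2^g$ by $\sigma(a)=Ma+w$, let $M_g(\sigma)$ be the $(0,1)$-matrix with nonzero entries exactly at positions $(a,\sigma(a))$, $a\in\mathbb{F}_2^g$. Let $\widetilde T_g,\widetilde E_g,\widetilde M_g(\sigma)$ be the block-diagonal $2^{g+1}\times2^{g+1}$ matrices with two copies of $T_g$, $E_g$, $M_g(\sigma)$ respectively on the diagonal, and let $\eta_8=(1+i)/\sqrt2$ (acting as the scalar matrix $\eta_8 I$). Then $G_g=\langle \widetilde T_g,\widetilde E_g,\widetilde M_g(\sigma)\ (\sigma\in\mathbb{F}_2^g\rtimes\mathrm{GL}(g,\mathbb{F}_2)),\eta_8\rangle$. -}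

module Defs where

open import Level using (Level; _⊔_)
open import Data.Bool using (Bool; true; false; _∧_; _xor_; not; if_then_else_)
open import Data.Nat as ℕ using (ℕ; zero; suc)
open import Data.Nat.Divisibility using (_∣_)
open import Data.Vec as Vec using (Vec; []; _∷_; lookup)
open import Data.List as List using (List; []; _∷_; _++_; concatMap)
open import Data.Fin using (Fin)
open import Data.Nat.ListAction using (sum)
open import Data.Product using (_×_; _,_)
open import Relation.Binary.PropositionalEquality using (_≡_)
open import Algebra.Bundles using (CommutativeRing)

-- Linear algebra over F₂ = Bool (false = 0, true = 1, xor = +, ∧ = ·)

dot : ∀ {n} → Vec Bool n → Vec Bool n → Bool
dot [] [] = false
dot (a ∷ u) (b ∷ v) = (a ∧ b) xor dot u v

addV : ∀ {n} → Vec Bool n → Vec Bool n → Vec Bool n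
addV = Vec.zipWith _xor_

eqB : Bool → Bool → Bool
eqB a b = not (a xor b)

eqV : ∀ {n} → Vec Bool n → Vec Bool n → Bool
eqV [] [] = true
eqV (a ∷ u) (b ∷ v) = eqB a b ∧ eqV u v

weight : ∀ {n} → Vec Bool n → ℕ
weight [] = 0
weight (true ∷ v) = suc (weight v)
weight (false ∷ v) = weight v

allVecs : (n : ℕ) → List (Vec Bool n)
allVecs zero = [] ∷ []
allVecs (suc n) = concatMap (λ v → (false ∷ v) ∷ (true ∷ v) ∷ []) (allVecs n)

allTuples : (g n : ℕ) → List (Vec (Vec Bool n) g)
allTuples zero n = [] ∷ []
allTuples (suc g) n =
  concatMap (λ us → List.map (λ u → u ∷ us) (allVecs n)) (allTuples g n)

-- Codes: a code C ⊆ F₂^n is given by its (decidable) membership predicate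

Code : ℕ → Set
Code n = Vec Bool n → Bool

IsSelfDual : ∀ {n} → Code n → Set
IsSelfDual C = ∀ v → ((C v ≡ true) → (∀ c → C c ≡ true → dot v c ≡ false))
                   × ((∀ c → C c ≡ true → dot v c ≡ false) → C v ≡ true)

IsTypeII : ∀ {n} → Code n → Set
IsTypeII C = IsSelfDual C × (∀ c → C c ≡ true → 4 ∣ weight c)

allIn : ∀ {n g} → Code n → Vec (Vec Bool n) g → Bool
allIn C [] = true
allIn C (u ∷ us) = C u ∧ allIn C us

column : ∀ {n g} → Vec (Vec Bool n) g → Fin n → Vec Bool g
column us i = Vec.map (λ u → lookup u i) us

-- n_{a,X}(u_1,…,u_g) where X ⊆ [n] is given by its characteristic vector
nCount : ∀ {n g} → Vec Bool n → Vec (Vec Bool n) g → Vec Bool g → ℕ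
nCount {n} X us a =
  sum (List.map (λ i → if lookup X i ∧ eqV (column us i) a then 1 else 0)
                     (List.allFin n))

-- GL(g, F₂): matrices given by their rows; M a is the matrix-vector product
applyM : ∀ {g} → Vec (Vec Bool g) g → Vec Bool g → Vec Bool g
applyM M a = Vec.map (λ row → dot row a) M

IsInvertible : ∀ {g} → Vec (Vec Bool g) g → Set
IsInvertible {g} M = Data.Product.Σ (Vec (Vec Bool g) g) λ N →
  (∀ a → applyM N (applyM M a) ≡ a) × (∀ a → applyM M (applyM N a) ≡ a)

-- last coordinate a_g (g ≥ 1 in the theorem; value for g = 0 irrelevant)
lastBit : ∀ {g} → Vec Bool g → Bool
lastBit [] = false
lastBit (a ∷ []) = a
lastBit (a ∷ b ∷ v) = lastBit (b ∷ v)

-- Variables: index (false , a) is x_a, index (true , a) is y_a.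

Ix : ℕ → Set
Ix g = Bool × Vec Bool g

allIx : (g : ℕ) → List (Ix g)
allIx g = List.map (false ,_) (allVecs g) ++ List.map (true ,_) (allVecs g)

eqIx : ∀ {g} → Ix g → Ix g → Bool
eqIx (s , a) (t , b) = eqB s t ∧ eqV a b

-- Everything over a commutative ring R with ζ (playing η₈, ζ⁴ = -1)
-- and half (= 1/2).  i := ζ², √2 = ζ - ζ³ (not needed).

module Over {c ℓ : Level} (R : CommutativeRing c ℓ) (ζ half : CommutativeRing.Carrier R) where
  open CommutativeRing R

  powR : Carrier → ℕ → Carrier
  powR x zero = 1#
  powR x (suc k) = x * powR x k

  sumL : ∀ {A : Set} → List A → (A → Carrier) → Carrier
  sumL xs f = List.foldr (λ x acc → f x + acc) 0# xs

  prodL : ∀ {A : Set} → List A → (A → Carrier) → Carrier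
  prodL xs f = List.foldr (λ x acc → f x * acc) 1# xs

  iR : Carrier
  iR = ζ * ζ

  Point : ℕ → Set c
  Point g = Ix g → Carrier

  jacobi : ∀ {n} (g : ℕ) → Code n → Vec Bool n → Point g → Carrier
  jacobi {n} g C T v =
    sumL (allTuples g n) λ us →
      if allIn C us
      then prodL (allVecs g) (λ a →
             powR (v (true , a)) (nCount T us a)
             * powR (v (false , a)) (nCount (Vec.map not T) us a))
      else 0#

  Matrix : ℕ → Set c
  Matrix g = Ix g → Ix g → Carrier

  -- (τ f)(v) = f(τ v)
  act : ∀ {g} → Matrix g → Point g → Point g
  act {g} τ v r = sumL (allIx g) λ k → τ r k * v k

  _·ₘ_ : ∀ {g} → Matrix g → Matrix g → Matrix g
  _·ₘ_ {g} A B r s = sumL (allIx g) λ k → A r k * B k s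

  idM : ∀ {g} → Matrix g
  idM r s = if eqIx r s then 1# else 0#

  blockDiag : ∀ {g} → (Vec Bool g → Vec Bool g → Carrier) → Matrix g
  blockDiag B (s , a) (t , b) = if eqB s t then B a b else 0#

  Tg : ∀ {g} → Vec Bool g → Vec Bool g → Carrier
  Tg {g} a b = powR (half * (1# + iR)) g * (if dot a b then - 1# else 1#)

  Eg : ∀ {g} → Vec Bool g → Vec Bool g → Carrier
  Eg a b = if eqV a b then (if lastBit a then iR else 1#) else 0#

  Mσ : ∀ {g} → Vec Bool g → Vec (Vec Bool g) g → Vec Bool g → Vec Bool g → Carrier
  Mσ w M a b = if eqV b (addV (applyM M a) w) then 1# else 0#

  ηM : ∀ {g} → Matrix g
  ηM r s = if eqIx r s then ζ else 0#

  -- the group G_g generated by T̃_g, Ẽ_g, M̃_g(σ), η₈ (as a set of matrices,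
  -- closed under entrywise ≈)
  data InG (g : ℕ) : Matrix g → Set (c ⊔ ℓ) where
    genT : InG g (blockDiag Tg)
    genE : InG g (blockDiag Eg)
    genM : (w : Vec Bool g) (M : Vec (Vec Bool g) g) → IsInvertible M →
           InG g (blockDiag (Mσ w M))
    genη : InG g ηM
    one  : InG g idM
    mul  : ∀ {A B} → InG g A → InG g B → InG g (A ·ₘ B)
    inv  : ∀ {A B} → InG g A → (∀ r s → (B ·ₘ A) r s ≈ idM r s) → InG g B
    resp : ∀ {A B} → InG g A → (∀ r s → A r s ≈ B r s) → InG g B

-- Regroup the Jacobi polynomial by coordinates: J v is the sum over u ∈ C^g of the product over
-- the coordinates i of the variable indexed by (T_i, i-th column of u).  Each generator of G_g
-- preserves J.  An affine map σ permutes C^g, since C is linear and contains the all-one word.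
-- Ẽ and η₈ rescale the term of u by i^wt(last row of u) and η₈^n, both 1 because weights are
-- divisible by 4 and 8 ∣ n.  T̃ is a MacWilliams transform: expanding the products and using
-- Σ_{u ∈ C} (-1)^(u·w) = |C| [w ∈ C] returns J multiplied by ((1+i)/2)^(ng) |C|^g = 1.
-- The scalar identities come from the Gauss sum Σ_x i^wt(x) = (1+i)^n, which equals |C| for a
-- Type II code (translate by codewords, then use the character sum), together with |C|² = 2^n;
-- comparing with |C| = 4^(n/4), obtained in ℤ, and (1+i)^4 = -4 gives 8 ∣ n.  Invariance passes
-- to products and to ≈-equal matrices at once, and to left inverses because every element of
-- G_g also acts surjectively on points.

module Submission where

open import Defs
open import Level using (Level)
open import Data.Nat using (ℕ; _≤_)
open import Data.Bool using (Bool)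
open import Data.Vec using (Vec)
open import Algebra.Bundles using (CommutativeRing)

open import Level using (_⊔_)
open import Data.Bool using (true; false; _∧_; _xor_; not; if_then_else_)
open import Data.Bool.Properties
  using (∧-comm; not-involutive; xor-assoc; xor-comm; xor-same; xor-identityʳ; ∧-distribʳ-xor; xor-∧-commutativeRing; ⇔→≡)
open import Data.Nat as ℕ using (zero; suc)
import Data.Nat.Properties as ℕ
open import Data.Nat.Divisibility using (_∣_; divides)
open import Data.Nat.ListAction using (sum)
open import Data.Integer as ℤ using (+_)
import Data.Integer.Properties as ℤ
open import Data.Fin using (Fin)
import Data.Fin as Fin
open import Data.Vec as Vec using ([]; _∷_; lookup)
import Data.Vec.Properties as Vec
open import Data.List as List using (List; []; _∷_; _++_; concatMap)
import Data.List.Properties as List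
open import Data.Product using (Σ; _×_; _,_; proj₁; proj₂)
open import Data.Sum using (_⊎_; inj₁; inj₂)
open import Data.Empty using (⊥-elim)
open import Relation.Nullary using (contradiction)
open import Function.Bundles using (mk⇔)
open import Relation.Binary.Definitions using (tri<; tri≈; tri>)
open import Relation.Binary.PropositionalEquality as ≡ using (_≡_)
open import Algebra.Bundles using (CommutativeMonoid)
import Algebra.Properties.CommutativeSemigroup as CommutativeSemigroupProperties
import Algebra.Properties.Ring as RingProperties
import Algebra.Properties.CommutativeSemiring.Exp as Exp
import Algebra.Properties.Semiring.Mult as Mult
import Algebra.Solver.CommutativeMonoid as CMSolver
import Relation.Binary.Reasoning.Setoid as SetoidReasoning

zeros : ∀ n → Vec Bool n
zeros n = Vec.replicate n false

eqV-refl : ∀ {n} (a : Vec Bool n) → eqV a a ≡ true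
eqV-refl [] = ≡.refl
eqV-refl (false ∷ a) = eqV-refl a
eqV-refl (true ∷ a) = eqV-refl a

eqV⇒≡ : ∀ {n} {a b : Vec Bool n} → eqV a b ≡ true → a ≡ b
eqV⇒≡ {a = []} {[]} _ = ≡.refl
eqV⇒≡ {a = false ∷ a} {false ∷ b} e = ≡.cong (false ∷_) (eqV⇒≡ e)
eqV⇒≡ {a = true ∷ a} {true ∷ b} e = ≡.cong (true ∷_) (eqV⇒≡ e)

eqV-sym : ∀ {n} (a b : Vec Bool n) → eqV a b ≡ eqV b a
eqV-sym [] [] = ≡.refl
eqV-sym (false ∷ a) (false ∷ b) = eqV-sym a b
eqV-sym (false ∷ a) (true ∷ b) = ≡.refl
eqV-sym (true ∷ a) (false ∷ b) = ≡.refl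
eqV-sym (true ∷ a) (true ∷ b) = eqV-sym a b

eqV-addV-zeros : ∀ {n} (a b : Vec Bool n) → eqV (addV a b) (zeros n) ≡ eqV a b
eqV-addV-zeros [] [] = ≡.refl
eqV-addV-zeros (false ∷ a) (false ∷ b) = eqV-addV-zeros a b
eqV-addV-zeros (false ∷ a) (true ∷ b) = ≡.refl
eqV-addV-zeros (true ∷ a) (false ∷ b) = ≡.refl
eqV-addV-zeros (true ∷ a) (true ∷ b) = eqV-addV-zeros a b

eqTuple : ∀ {n g} → Vec (Vec Bool n) g → Vec (Vec Bool n) g → Bool
eqTuple [] [] = true
eqTuple (u ∷ us) (w ∷ ws) = eqV u w ∧ eqTuple us ws

eqTuple-refl : ∀ {n g} (us : Vec (Vec Bool n) g) → eqTuple us us ≡ true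
eqTuple-refl [] = ≡.refl
eqTuple-refl (u ∷ us) rewrite eqV-refl u = eqTuple-refl us

eqTuple⇒≡ : ∀ {n g} {us ws : Vec (Vec Bool n) g} → eqTuple us ws ≡ true → us ≡ ws
eqTuple⇒≡ {us = []} {[]} _ = ≡.refl
eqTuple⇒≡ {us = u ∷ us} {w ∷ ws} e with eqV u w in e₁
... | true = ≡.cong₂ _∷_ (eqV⇒≡ e₁) (eqTuple⇒≡ e)

module F₂ = CommutativeSemigroupProperties (CommutativeRing.+-commutativeSemigroup xor-∧-commutativeRing)

dot-comm : ∀ {n} (u v : Vec Bool n) → dot u v ≡ dot v u
dot-comm [] [] = ≡.refl
dot-comm (a ∷ u) (b ∷ v) = ≡.cong₂ _xor_ (∧-comm a b) (dot-comm u v)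

dot-addˡ : ∀ {n} (x y z : Vec Bool n) → dot (addV x y) z ≡ dot x z xor dot y z
dot-addˡ [] [] [] = ≡.refl
dot-addˡ (a ∷ x) (b ∷ y) (c ∷ z) = begin
  ((a xor b) ∧ c) xor dot (addV x y) z        ≡⟨ ≡.cong₂ _xor_ (∧-distribʳ-xor c a b) (dot-addˡ x y z) ⟩
  ((a ∧ c) xor (b ∧ c)) xor (dot x z xor dot y z) ≡⟨ F₂.interchange (a ∧ c) (b ∧ c) (dot x z) (dot y z) ⟩
  ((a ∧ c) xor dot x z) xor ((b ∧ c) xor dot y z) ∎
  where open ≡.≡-Reasoning

dot-addʳ : ∀ {n} (x y z : Vec Bool n) → dot x (addV y z) ≡ dot x y xor dot x z
dot-addʳ x y z = begin
  dot x (addV y z)      ≡⟨ dot-comm x (addV y z) ⟩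
  dot (addV y z) x      ≡⟨ dot-addˡ y z x ⟩
  dot y x xor dot z x   ≡⟨ ≡.cong₂ _xor_ (dot-comm y x) (dot-comm z x) ⟩
  dot x y xor dot x z   ∎
  where open ≡.≡-Reasoning

dot-zerosˡ : ∀ {n} (z : Vec Bool n) → dot (zeros n) z ≡ false
dot-zerosˡ [] = ≡.refl
dot-zerosˡ (c ∷ z) = dot-zerosˡ z

addV-cancelʳ : ∀ {n} (x y : Vec Bool n) → addV (addV x y) y ≡ x
addV-cancelʳ [] [] = ≡.refl
addV-cancelʳ (a ∷ x) (b ∷ y) = ≡.cong₂ _∷_
  (≡.trans (xor-assoc a b b) (≡.trans (≡.cong (a xor_) (xor-same b)) (xor-identityʳ a)))
  (addV-cancelʳ x y)


allIn-head : ∀ {n g} (C : Code n) u (us : Vec (Vec Bool n) g) → allIn C (u ∷ us) ≡ true → C u ≡ true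
allIn-head C u us e with C u
... | true = ≡.refl

allIn-tail : ∀ {n g} (C : Code n) u (us : Vec (Vec Bool n) g) → allIn C (u ∷ us) ≡ true → allIn C us ≡ true
allIn-tail C u us e with C u
... | true = e

allIn-∷ : ∀ {n g} (C : Code n) u (us : Vec (Vec Bool n) g) → C u ≡ true → allIn C us ≡ true → allIn C (u ∷ us) ≡ true
allIn-∷ C u us u∈C us∈C rewrite u∈C = us∈C

-- Row-wise counterpart of lastBit, including its value at g = 0.
lastRow : ∀ {g n} → Vec (Vec Bool n) g → Vec Bool n
lastRow [] = zeros _
lastRow (u ∷ []) = u
lastRow (u ∷ v ∷ vs) = lastRow (v ∷ vs)

lastBit-column : ∀ {g n} (us : Vec (Vec Bool n) g) i → lastBit (column us i) ≡ lookup (lastRow us) i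
lastBit-column [] i = ≡.sym (Vec.lookup-replicate i false)
lastBit-column (u ∷ []) i = ≡.refl
lastBit-column (u ∷ v ∷ vs) i = lastBit-column (v ∷ vs) i

≡-byColumns : ∀ {g n} {us vs : Vec (Vec Bool n) g} → (∀ i → column us i ≡ column vs i) → us ≡ vs
≡-byColumns {us = []} {[]} _ = ≡.refl
≡-byColumns {us = u ∷ us} {v ∷ vs} same =
  ≡.cong₂ _∷_ (≡-byLookups (λ i → ≡.cong Vec.head (same i))) (≡-byColumns (λ i → ≡.cong Vec.tail (same i)))
  where
    ≡-byLookups : ∀ {n} {u v : Vec Bool n} → (∀ i → lookup u i ≡ lookup v i) → u ≡ v
    ≡-byLookups {u = u} {v} same = ≡.trans (≡.sym (Vec.tabulate∘lookup u)) (≡.trans (Vec.tabulate-cong same) (Vec.tabulate∘lookup v))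

-- applyM of Defs for non-square matrices: applyM M a is applyRows M a by definition.
applyRows : ∀ {k g} → Vec (Vec Bool g) k → Vec Bool g → Vec Bool k
applyRows M a = Vec.map (λ row → dot row a) M

applyRows-addV : ∀ {k g} (M : Vec (Vec Bool g) k) (x y : Vec Bool g) → applyRows M (addV x y) ≡ addV (applyRows M x) (applyRows M y)
applyRows-addV [] x y = ≡.refl
applyRows-addV (row ∷ M) x y = ≡.cong₂ _∷_ (dot-addʳ row x y) (applyRows-addV M x y)

affine : ∀ {k g} → Vec (Vec Bool g) k → Vec Bool k → Vec Bool g → Vec Bool k
affine M w a = addV (applyRows M a) w

linComb : ∀ {k n} → Vec Bool k → Vec (Vec Bool n) k → Vec Bool n
linComb {n = n} [] [] = zeros n
linComb {n = n} (m ∷ row) (u ∷ us) = addV (if m then u else zeros n) (linComb row us)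

lookup-linComb : ∀ {k n} (row : Vec Bool k) (us : Vec (Vec Bool n) k) i → lookup (linComb row us) i ≡ dot row (column us i)
lookup-linComb [] [] i = Vec.lookup-replicate i false
lookup-linComb (m ∷ row) (u ∷ us) i = ≡.trans (Vec.lookup-zipWith _xor_ i (if m then u else zeros _) (linComb row us))
  (≡.cong₂ _xor_ (lookup-scaled m) (lookup-linComb row us i))
  where
    lookup-scaled : ∀ m → lookup (if m then u else zeros _) i ≡ m ∧ lookup u i
    lookup-scaled true = ≡.refl
    lookup-scaled false = Vec.lookup-replicate i false

affineTuple : ∀ {k g n} → Vec (Vec Bool g) k → Vec Bool k → Vec (Vec Bool n) g → Vec (Vec Bool n) k
affineTuple {n = n} M w us = Vec.zipWith (λ row wⱼ → addV (linComb row us) (Vec.replicate n wⱼ)) M w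

column-affineTuple : ∀ {k g n} (M : Vec (Vec Bool g) k) (w : Vec Bool k) (us : Vec (Vec Bool n) g) i →
                     column (affineTuple M w us) i ≡ affine M w (column us i)
column-affineTuple [] [] us i = ≡.refl
column-affineTuple {n = n} (row ∷ M) (wⱼ ∷ w) us i = ≡.cong₂ _∷_
  (≡.trans (Vec.lookup-zipWith _xor_ i (linComb row us) (Vec.replicate n wⱼ))
           (≡.cong₂ _xor_ (lookup-linComb row us i) (Vec.lookup-replicate i wⱼ)))
  (column-affineTuple M w us i)

module AffineInverse {g : ℕ} {M N : Vec (Vec Bool g) g}
  (NM : ∀ a → applyM N (applyM M a) ≡ a) (MN : ∀ a → applyM M (applyM N a) ≡ a) (w : Vec Bool g) where

  w′ : Vec Bool g
  w′ = applyM N w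

  affine-inverseˡ : ∀ a → affine N w′ (affine M w a) ≡ a
  affine-inverseˡ a = ≡.trans (≡.cong (λ z → addV z w′) (applyRows-addV N (applyM M a) w))
    (≡.trans (addV-cancelʳ (applyM N (applyM M a)) w′) (NM a))

  affine-inverseʳ : ∀ b → affine M w (affine N w′ b) ≡ b
  affine-inverseʳ b = ≡.trans (≡.cong (λ z → addV z w) (applyRows-addV M (applyM N b) w′))
    (≡.trans (≡.cong₂ (λ z z′ → addV (addV z z′) w) (MN b) (MN w)) (addV-cancelʳ b w))

  affineTuple-inverseˡ : ∀ {n} (us : Vec (Vec Bool n) g) → affineTuple N w′ (affineTuple M w us) ≡ us
  affineTuple-inverseˡ us = ≡-byColumns λ i → ≡.trans (column-affineTuple N w′ _ i)
    (≡.trans (≡.cong (affine N w′) (column-affineTuple M w us i)) (affine-inverseˡ (column us i)))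

  affineTuple-inverseʳ : ∀ {n} (us : Vec (Vec Bool n) g) → affineTuple M w (affineTuple N w′ us) ≡ us
  affineTuple-inverseʳ us = ≡-byColumns λ i → ≡.trans (column-affineTuple M w _ i)
    (≡.trans (≡.cong (affine M w) (column-affineTuple N w′ us i)) (affine-inverseʳ (column us i)))


tupleDot : ∀ {n g} → Vec (Vec Bool n) g → Vec (Vec Bool n) g → Bool
tupleDot [] [] = false
tupleDot (u ∷ us) (w ∷ ws) = dot u w xor tupleDot us ws


consColumn : ∀ {g n} → Vec Bool g → Vec (Vec Bool n) g → Vec (Vec Bool (suc n)) g
consColumn = Vec.zipWith _∷_

column-consColumn-zero : ∀ {g n} (b : Vec Bool g) (ws : Vec (Vec Bool n) g) → column (consColumn b ws) Fin.zero ≡ b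
column-consColumn-zero [] [] = ≡.refl
column-consColumn-zero (x ∷ b) (w ∷ ws) = ≡.cong (x ∷_) (column-consColumn-zero b ws)

column-consColumn-suc : ∀ {g n} (b : Vec Bool g) (ws : Vec (Vec Bool n) g) i → column (consColumn b ws) (Fin.suc i) ≡ column ws i
column-consColumn-suc [] [] i = ≡.refl
column-consColumn-suc (x ∷ b) (w ∷ ws) i = ≡.cong (lookup w i ∷_) (column-consColumn-suc b ws i)

search : ∀ n (f : Vec Bool n → Bool) → (Σ (Vec Bool n) λ c → f c ≡ true) ⊎ (∀ c → f c ≡ false)
search zero f with f [] in e
... | true  = inj₁ ([] , e)
... | false = inj₂ λ { [] → e }
search (suc n) f with search n (λ v → f (false ∷ v)) | search n (λ v → f (true ∷ v))
... | inj₁ (c , e) | _            = inj₁ (false ∷ c , e)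
... | inj₂ _       | inj₁ (c , e) = inj₁ (true ∷ c , e)
... | inj₂ none₀   | inj₂ none₁   = inj₂ λ { (false ∷ c) → none₀ c ; (true ∷ c) → none₁ c }

module SelfDual {n : ℕ} {C : Code n} (sd : IsSelfDual C) where

  zeros∈C : C (zeros n) ≡ true
  zeros∈C = proj₂ (sd (zeros n)) (λ c _ → dot-zerosˡ c)

  addV∈C : ∀ {u v} → C u ≡ true → C v ≡ true → C (addV u v) ≡ true
  addV∈C {u} {v} u∈C v∈C = proj₂ (sd _) λ c c∈C → ≡.trans (dot-addˡ u v c)
    (≡.cong₂ _xor_ (proj₁ (sd u) u∈C c c∈C) (proj₁ (sd v) v∈C c c∈C))

  C-addV-invariant : ∀ u {c} → C c ≡ true → C (addV u c) ≡ C u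
  C-addV-invariant u {c} c∈C = ⇔→≡ (mk⇔
    (λ u+c∈C → ≡.subst (λ x → C x ≡ true) (addV-cancelʳ u c) (addV∈C u+c∈C c∈C))
    (λ u∈C → addV∈C u∈C c∈C))

  ∉C⇒nonorthogonal : ∀ {w} → C w ≡ false → Σ (Vec Bool n) λ c → C c ≡ true × dot w c ≡ true
  ∉C⇒nonorthogonal {w} w∉C with search n (λ c → C c ∧ dot w c)
  ... | inj₁ (c , e) with C c in c∈C
  ...   | true = c , c∈C , e
  ∉C⇒nonorthogonal {w} w∉C | inj₂ none = contradiction (≡.trans (≡.sym w∉C) (proj₂ (sd w) orthogonal)) λ ()
    where
      orthogonal : ∀ c → C c ≡ true → dot w c ≡ false
      orthogonal c c∈C with none c
      ... | e rewrite c∈C = e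

ones : ∀ n → Vec Bool n
ones n = Vec.replicate n true

parity : ℕ → Bool
parity zero = false
parity (suc k) = not (parity k)

dot-ones : ∀ {n} (c : Vec Bool n) → dot (ones n) c ≡ parity (weight c)
dot-ones [] = ≡.refl
dot-ones (false ∷ c) = dot-ones c
dot-ones (true ∷ c) = ≡.cong not (dot-ones c)

parity-*4 : ∀ q → parity (q ℕ.* 4) ≡ false
parity-*4 zero = ≡.refl
parity-*4 (suc q) = ≡.trans (not-involutive _) (≡.trans (not-involutive _) (parity-*4 q))

weight-ones : ∀ n → weight (ones n) ≡ n
weight-ones zero = ≡.refl
weight-ones (suc n) = ≡.cong suc (weight-ones n)

module TypeII {n : ℕ} {C : Code n} (typeII : IsTypeII C) where
  open SelfDual (proj₁ typeII) public

  ones∈C : C (ones n) ≡ true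
  ones∈C = proj₂ (proj₁ typeII (ones n)) λ c c∈C → ones-orthogonal c (proj₂ typeII c c∈C)
    where
      ones-orthogonal : ∀ c → 4 ∣ weight c → dot (ones n) c ≡ false
      ones-orthogonal c (divides q eq) = ≡.trans (dot-ones c) (≡.trans (≡.cong parity eq) (parity-*4 q))

  4∣n : 4 ∣ n
  4∣n = ≡.subst (4 ∣_) (weight-ones n) (proj₂ typeII (ones n) ones∈C)

module TupleMembership {n : ℕ} {C : Code n} (typeII : IsTypeII C) where
  open TypeII typeII

  linComb∈C : ∀ {k} (row : Vec Bool k) {us : Vec (Vec Bool n) k} → allIn C us ≡ true → C (linComb row us) ≡ true
  linComb∈C [] {[]} _ = zeros∈C
  linComb∈C (true ∷ row) {u ∷ us} e = addV∈C (allIn-head C u us e) (linComb∈C row (allIn-tail C u us e))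
  linComb∈C (false ∷ row) {u ∷ us} e = addV∈C zeros∈C (linComb∈C row (allIn-tail C u us e))

  lastRow∈C : ∀ {g} (us : Vec (Vec Bool n) g) → allIn C us ≡ true → C (lastRow us) ≡ true
  lastRow∈C [] _ = zeros∈C
  lastRow∈C (u ∷ []) e = allIn-head C u [] e
  lastRow∈C (u ∷ v ∷ vs) e = lastRow∈C (v ∷ vs) (allIn-tail C u (v ∷ vs) e)

  replicate∈C : ∀ b → C (Vec.replicate n b) ≡ true
  replicate∈C true = ones∈C
  replicate∈C false = zeros∈C

  affineTuple∈C : ∀ {k g} (M : Vec (Vec Bool g) k) (w : Vec Bool k) {us : Vec (Vec Bool n) g} →
                  allIn C us ≡ true → allIn C (affineTuple M w us) ≡ true
  affineTuple∈C [] [] e = ≡.refl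
  affineTuple∈C (row ∷ M) (wⱼ ∷ w) {us} e =
    allIn-∷ C _ (affineTuple M w us) (addV∈C (linComb∈C row e) (replicate∈C wⱼ)) (affineTuple∈C M w e)

  allIn-affineTuple : ∀ {g} {M N : Vec (Vec Bool g) g} (NM : ∀ a → applyM N (applyM M a) ≡ a) (MN : ∀ a → applyM M (applyM N a) ≡ a)
                      (w : Vec Bool g) (us : Vec (Vec Bool n) g) → allIn C (affineTuple M w us) ≡ allIn C us
  allIn-affineTuple {M = M} {N} NM MN w us = ⇔→≡ (mk⇔
    (λ σus∈C → ≡.subst (λ vs → allIn C vs ≡ true) (affineTuple-inverseˡ us) (affineTuple∈C N w′ σus∈C))
    (affineTuple∈C M w))
    where open AffineInverse NM MN w

module Folds {c ℓ : Level} (M : CommutativeMonoid c ℓ) where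
  open CommutativeMonoid M renaming (Carrier to A)
  open SetoidReasoning setoid

  fold : ∀ {X : Set} → List X → (X → A) → A
  fold xs f = List.foldr (λ x acc → f x ∙ acc) ε xs

  fold-cong : ∀ {X : Set} (xs : List X) {f g : X → A} → (∀ x → f x ≈ g x) → fold xs f ≈ fold xs g
  fold-cong [] h = refl
  fold-cong (x ∷ xs) h = ∙-cong (h x) (fold-cong xs h)

  fold-ε : ∀ {X : Set} (xs : List X) → fold xs (λ _ → ε) ≈ ε
  fold-ε [] = refl
  fold-ε (x ∷ xs) = trans (identityˡ _) (fold-ε xs)

  fold-++ : ∀ {X : Set} (xs ys : List X) (f : X → A) → fold (xs ++ ys) f ≈ fold xs f ∙ fold ys f
  fold-++ [] ys f = sym (identityˡ _)
  fold-++ (x ∷ xs) ys f = trans (∙-congˡ (fold-++ xs ys f)) (sym (assoc _ _ _))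

  fold-map : ∀ {X Y : Set} (h : X → Y) (xs : List X) (f : Y → A) → fold (List.map h xs) f ≡ fold xs (λ x → f (h x))
  fold-map h [] f = ≡.refl
  fold-map h (x ∷ xs) f = ≡.cong (f (h x) ∙_) (fold-map h xs f)

  fold-concatMap : ∀ {X Y : Set} (h : X → List Y) (xs : List X) (f : Y → A) →
                   fold (concatMap h xs) f ≈ fold xs (λ x → fold (h x) f)
  fold-concatMap h [] f = refl
  fold-concatMap h (x ∷ xs) f = trans (fold-++ (h x) (concatMap h xs) f) (∙-congˡ (fold-concatMap h xs f))

  fold-∙ : ∀ {X : Set} (xs : List X) (f g : X → A) → fold xs (λ x → f x ∙ g x) ≈ fold xs f ∙ fold xs g
  fold-∙ [] f g = sym (identityˡ _)
  fold-∙ (x ∷ xs) f g = trans (∙-congˡ (fold-∙ xs f g)) (interchange (f x) (g x) (fold xs f) (fold xs g))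
    where open CommutativeSemigroupProperties commutativeSemigroup using (interchange)

  fold-swap : ∀ {X Y : Set} (xs : List X) (ys : List Y) (f : X → Y → A) →
              fold xs (λ x → fold ys (f x)) ≈ fold ys (λ y → fold xs (λ x → f x y))
  fold-swap [] ys f = sym (fold-ε ys)
  fold-swap (x ∷ xs) ys f = trans (∙-congˡ (fold-swap xs ys f)) (sym (fold-∙ ys (f x) _))

  fold-if : ∀ {X : Set} (xs : List X) (b : Bool) (f : X → A) →
            fold xs (λ x → if b then f x else ε) ≈ (if b then fold xs f else ε)
  fold-if xs true f = refl
  fold-if xs false f = fold-ε xs

  fold-allFin-suc : ∀ n (h : Fin (suc n) → A) →
                    fold (List.allFin (suc n)) h ≡ h Fin.zero ∙ fold (List.allFin n) (λ i → h (Fin.suc i))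
  fold-allFin-suc n h = ≡.cong (h Fin.zero ∙_) (≡.trans
    (≡.cong (λ xs → fold xs h) (≡.sym (List.map-tabulate (λ i → i) Fin.suc)))
    (fold-map Fin.suc (List.allFin n) h))

  fold-allVecs-suc : ∀ n (f : Vec Bool (suc n) → A) →
                     fold (allVecs (suc n)) f ≈ fold (allVecs n) (λ v → f (false ∷ v) ∙ f (true ∷ v))
  fold-allVecs-suc n f = trans (fold-concatMap _ (allVecs n) f) (fold-cong (allVecs n) λ v → ∙-congˡ (identityʳ _))

  fold-allTuples-suc : ∀ g n (f : Vec (Vec Bool n) (suc g) → A) →
                       fold (allTuples (suc g) n) f ≈ fold (allTuples g n) (λ us → fold (allVecs n) (λ u → f (u ∷ us)))
  fold-allTuples-suc g n f = trans (fold-concatMap _ (allTuples g n) f)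
    (fold-cong (allTuples g n) (λ us → reflexive (fold-map (_∷ us) (allVecs n) f)))

  -- The sifting property says that xs lists each element of X exactly once (for the test eq).
  Sifts : ∀ {X : Set} → List X → (X → X → Bool) → Set (c ⊔ ℓ)
  Sifts {X} xs eq = ∀ b (f : X → A) → fold xs (λ a → if eq b a then f a else ε) ≈ f b

  allVecs-sifts : ∀ n → Sifts (allVecs n) eqV
  allVecs-sifts zero [] f = identityʳ _
  allVecs-sifts (suc n) (false ∷ b) f = begin
    fold (allVecs (suc n)) _                                      ≈⟨ fold-allVecs-suc n _ ⟩
    fold (allVecs n) (λ v → (if eqV b v then f (false ∷ v) else ε) ∙ ε) ≈⟨ fold-cong (allVecs n) (λ v → identityʳ _) ⟩
    fold (allVecs n) (λ v → if eqV b v then f (false ∷ v) else ε) ≈⟨ allVecs-sifts n b _ ⟩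
    f (false ∷ b)                                                 ∎
  allVecs-sifts (suc n) (true ∷ b) f = begin
    fold (allVecs (suc n)) _                                      ≈⟨ fold-allVecs-suc n _ ⟩
    fold (allVecs n) (λ v → ε ∙ (if eqV b v then f (true ∷ v) else ε)) ≈⟨ fold-cong (allVecs n) (λ v → identityˡ _) ⟩
    fold (allVecs n) (λ v → if eqV b v then f (true ∷ v) else ε)  ≈⟨ allVecs-sifts n b _ ⟩
    f (true ∷ b)                                                  ∎

  allTuples-sifts : ∀ g n → Sifts (allTuples g n) eqTuple
  allTuples-sifts zero n [] f = identityʳ _
  allTuples-sifts (suc g) n (b ∷ bs) f = begin
    fold (allTuples (suc g) n) _
      ≈⟨ fold-allTuples-suc g n _ ⟩
    fold (allTuples g n) (λ us → fold (allVecs n) (λ u → if eqV b u ∧ eqTuple bs us then f (u ∷ us) else ε))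
      ≈⟨ fold-cong (allTuples g n) (λ us → fold-cong (allVecs n) (λ u → reflexive (if-∧ (eqV b u) (eqTuple bs us)))) ⟩
    fold (allTuples g n) (λ us → fold (allVecs n) (λ u → if eqTuple bs us then (if eqV b u then f (u ∷ us) else ε) else ε))
      ≈⟨ fold-cong (allTuples g n) (λ us → fold-if (allVecs n) (eqTuple bs us) _) ⟩
    fold (allTuples g n) (λ us → if eqTuple bs us then fold (allVecs n) (λ u → if eqV b u then f (u ∷ us) else ε) else ε)
      ≈⟨ allTuples-sifts g n bs _ ⟩
    fold (allVecs n) (λ u → if eqV b u then f (u ∷ bs) else ε)
      ≈⟨ allVecs-sifts n b _ ⟩
    f (b ∷ bs) ∎
    where
      if-∧ : ∀ {z : A} p q → (if p ∧ q then z else ε) ≡ (if q then (if p then z else ε) else ε)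
      if-∧ true q = ≡.refl
      if-∧ false true = ≡.refl
      if-∧ false false = ≡.refl

  fold-bijection : ∀ {X : Set} {xs : List X} {eq : X → X → Bool} → Sifts xs eq →
                   (∀ x → eq x x ≡ true) → (∀ {x y} → eq x y ≡ true → x ≡ y) →
                   (φ ψ : X → X) → (∀ x → ψ (φ x) ≡ x) → (∀ y → φ (ψ y) ≡ y) →
                   (f : X → A) → fold xs (λ x → f (φ x)) ≈ fold xs f
  fold-bijection {xs = xs} {eq} sifts eq-refl eq⇒≡ φ ψ ψφ φψ f = begin
    fold xs (λ x → f (φ x))                                      ≈⟨ fold-cong xs (λ x → sym (sifts (φ x) f)) ⟩
    fold xs (λ x → fold xs (λ y → if eq (φ x) y then f y else ε)) ≈⟨ fold-swap xs xs _ ⟩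
    fold xs (λ y → fold xs (λ x → if eq (φ x) y then f y else ε)) ≈⟨ fold-cong xs (λ y → fold-cong xs (λ x →
                                                                      reflexive (≡.cong (λ t → if t then f y else ε) (test-transpose x y)))) ⟩
    fold xs (λ y → fold xs (λ x → if eq (ψ y) x then f y else ε)) ≈⟨ fold-cong xs (λ y → sifts (ψ y) (λ _ → f y)) ⟩
    fold xs f                                                    ∎
    where
      test-transpose : ∀ x y → eq (φ x) y ≡ eq (ψ y) x
      test-transpose x y with eq (φ x) y in e₁ | eq (ψ y) x in e₂
      ... | true  | true  = ≡.refl
      ... | false | false = ≡.refl
      ... | true  | false = ≡.trans (≡.sym (≡.trans (≡.cong (λ z → eq z x) ψy≡x) (eq-refl x))) e₂
        where ψy≡x = ≡.trans (≡.cong ψ (≡.sym (eq⇒≡ e₁))) (ψφ x)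
      ... | false | true  = ≡.trans (≡.sym e₁) (≡.trans (≡.cong (λ z → eq z y) φx≡y) (eq-refl y))
        where φx≡y = ≡.trans (≡.cong φ (≡.sym (eq⇒≡ e₂))) (φψ y)

  fold-allVecs-bijection : ∀ n (φ ψ : Vec Bool n → Vec Bool n) → (∀ x → ψ (φ x) ≡ x) → (∀ y → φ (ψ y) ≡ y) →
                           (f : Vec Bool n → A) → fold (allVecs n) (λ x → f (φ x)) ≈ fold (allVecs n) f
  fold-allVecs-bijection n = fold-bijection {xs = allVecs n} (allVecs-sifts n) eqV-refl eqV⇒≡

  fold-allVecs-translate : ∀ n (c : Vec Bool n) (f : Vec Bool n → A) →
                           fold (allVecs n) (λ x → f (addV x c)) ≈ fold (allVecs n) f
  fold-allVecs-translate n c =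
    fold-allVecs-bijection n (λ x → addV x c) (λ x → addV x c) (λ x → addV-cancelʳ x c) (λ x → addV-cancelʳ x c)

  fold-allTuples-bijection : ∀ g n (φ ψ : Vec (Vec Bool n) g → Vec (Vec Bool n) g) →
                             (∀ x → ψ (φ x) ≡ x) → (∀ y → φ (ψ y) ≡ y) →
                             (f : Vec (Vec Bool n) g → A) → fold (allTuples g n) (λ x → f (φ x)) ≈ fold (allTuples g n) f
  fold-allTuples-bijection g n = fold-bijection {xs = allTuples g n} (allTuples-sifts g n) eqTuple-refl eqTuple⇒≡

  fold-allTuples-zero : ∀ g (f : Vec (Vec Bool 0) g → A) → fold (allTuples g 0) f ≈ f (Vec.replicate g [])
  fold-allTuples-zero zero f = identityʳ _
  fold-allTuples-zero (suc g) f = trans (fold-allTuples-suc g 0 f)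
    (trans (fold-cong (allTuples g 0) (λ us → identityʳ _)) (fold-allTuples-zero g (λ us → f ([] ∷ us))))

  fold-allTuples-byColumn : ∀ g n (f : Vec (Vec Bool (suc n)) g → A) →
    fold (allTuples g (suc n)) f ≈ fold (allVecs g) (λ b → fold (allTuples g n) (λ ws → f (consColumn b ws)))
  fold-allTuples-byColumn zero n f = sym (identityʳ _)
  fold-allTuples-byColumn (suc g) n f = begin
    fold (allTuples (suc g) (suc n)) f
      ≈⟨ fold-allTuples-suc g (suc n) f ⟩
    fold (allTuples g (suc n)) (λ us → fold (allVecs (suc n)) (λ u → f (u ∷ us)))
      ≈⟨ fold-allTuples-byColumn g n _ ⟩
    fold (allVecs g) (λ b → fold (allTuples g n) (λ ws → fold (allVecs (suc n)) (λ u → f (u ∷ consColumn b ws))))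
      ≈⟨ fold-cong (allVecs g) (λ b → fold-cong (allTuples g n) (λ ws → trans (fold-allVecs-suc n _) (fold-∙ (allVecs n) _ _))) ⟩
    fold (allVecs g) (λ b → fold (allTuples g n) (λ ws → fold (allVecs n) (λ u → f ((false ∷ u) ∷ consColumn b ws))
                                                        ∙ fold (allVecs n) (λ u → f ((true ∷ u) ∷ consColumn b ws))))
      ≈⟨ fold-cong (allVecs g) (λ b → fold-∙ (allTuples g n) _ _) ⟩
    fold (allVecs g) (λ b → fold (allTuples g n) (λ ws → fold (allVecs n) (λ u → f ((false ∷ u) ∷ consColumn b ws)))
                          ∙ fold (allTuples g n) (λ ws → fold (allVecs n) (λ u → f ((true ∷ u) ∷ consColumn b ws))))
      ≈⟨ fold-cong (allVecs g) (λ b → ∙-cong (fold-allTuples-suc g n _) (fold-allTuples-suc g n _)) ⟨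
    fold (allVecs g) (λ b → fold (allTuples (suc g) n) (λ ws → f (consColumn (false ∷ b) ws))
                          ∙ fold (allTuples (suc g) n) (λ ws → f (consColumn (true ∷ b) ws)))
      ≈⟨ fold-allVecs-suc g _ ⟨
    fold (allVecs (suc g)) (λ b → fold (allTuples (suc g) n) (λ ws → f (consColumn b ws))) ∎


size : ∀ {n} → Code n → ℕ
size {n} C = Folds.fold ℕ.+-0-commutativeMonoid (allVecs n) (λ u → if C u then 1 else 0)


2-TorsionFree : ∀ {c ℓ} → CommutativeRing c ℓ → Set (c ⊔ ℓ)
2-TorsionFree R = ∀ x → x + x ≈ 0# → x ≈ 0#
  where open CommutativeRing R

IsRootOfX⁴+1 : ∀ {c ℓ} (R : CommutativeRing c ℓ) → CommutativeRing.Carrier R → Set ℓ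
IsRootOfX⁴+1 R ζ = ζ * ζ * ζ * ζ ≈ - 1#
  where open CommutativeRing R

IsHalf : ∀ {c ℓ} (R : CommutativeRing c ℓ) → CommutativeRing.Carrier R → Set ℓ
IsHalf R half = (1# + 1#) * half ≈ 1#
  where open CommutativeRing R

module RingSums {c ℓ : Level} (R : CommutativeRing c ℓ) where
  open CommutativeRing R
  open RingProperties ring public using (-1*x≈-x; -‿distribˡ-*; -‿distribʳ-*; -‿involutive; -0#≈0#; -‿+-comm)
  open Exp commutativeSemiring public using (_^_; ^-congˡ; ^-homo-*; ^-assocʳ; ^-distrib-*)
  open SetoidReasoning setoid

  open Mult semiring public using (×-homo-+; ×1-homo-*) renaming (_×_ to _×ᴿ_)

  module ∑ = Folds +-commutativeMonoid
  module ∏ = Folds *-commutativeMonoid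
  module ℕ∑ = Folds ℕ.+-0-commutativeMonoid

  two : Carrier
  two = 1# + 1#

  two*x≈x+x : ∀ x → two * x ≈ x + x
  two*x≈x+x x = trans (distribʳ x 1# 1#) (+-cong (*-identityˡ x) (*-identityˡ x))

  χ : Bool → Carrier
  χ b = if b then - 1# else 1#

  -1*-1≈1 : - 1# * - 1# ≈ 1#
  -1*-1≈1 = trans (-1*x≈-x (- 1#)) (-‿involutive 1#)

  χ-xor : ∀ a b → χ (a xor b) ≈ χ a * χ b
  χ-xor false b = sym (*-identityˡ _)
  χ-xor true false = sym (*-identityʳ _)
  χ-xor true true = sym -1*-1≈1

  χ-not : ∀ a → χ (not a) ≈ - χ a
  χ-not false = refl
  χ-not true = sym (-‿involutive 1#)

  if-*ʳ : ∀ b x y → (if b then x else 0#) * y ≈ (if b then x * y else 0#)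
  if-*ʳ true x y = refl
  if-*ʳ false x y = zeroˡ y

  if-*ˡ : ∀ b x y → x * (if b then y else 0#) ≈ (if b then x * y else 0#)
  if-*ˡ true x y = refl
  if-*ˡ false x y = zeroʳ x

  if-cong : ∀ b {x y} → x ≈ y → (if b then x else 0#) ≈ (if b then y else 0#)
  if-cong true x≈y = x≈y
  if-cong false x≈y = refl

  ∑-*ˡ : ∀ {X : Set} (xs : List X) k (f : X → Carrier) → k * ∑.fold xs f ≈ ∑.fold xs (λ x → k * f x)
  ∑-*ˡ [] k f = zeroʳ k
  ∑-*ˡ (x ∷ xs) k f = trans (distribˡ k _ _) (+-congˡ (∑-*ˡ xs k f))

  ∑-*ʳ : ∀ {X : Set} (xs : List X) k (f : X → Carrier) → ∑.fold xs f * k ≈ ∑.fold xs (λ x → f x * k)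
  ∑-*ʳ xs k f = trans (*-comm _ k) (trans (∑-*ˡ xs k f) (∑.fold-cong xs (λ x → *-comm k (f x))))

  ∑-neg : ∀ {X : Set} (xs : List X) (f : X → Carrier) → ∑.fold xs (λ x → - f x) ≈ - ∑.fold xs f
  ∑-neg [] f = sym -0#≈0#
  ∑-neg (x ∷ xs) f = trans (+-congˡ (∑-neg xs f)) (-‿+-comm _ _)

  ∏-const : ∀ n z → ∏.fold (List.allFin n) (λ _ → z) ≈ z ^ n
  ∏-const zero z = refl
  ∏-const (suc n) z = trans (reflexive (∏.fold-allFin-suc n (λ _ → z))) (*-congˡ (∏-const n z))

  card : ∀ {n} → Code n → Carrier
  card {n} C = ∑.fold (allVecs n) (λ u → if C u then 1# else 0#)

  card≈size×1 : ∀ {n} (C : Code n) → card C ≈ size C ×ᴿ 1#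
  card≈size×1 {n} C = go (allVecs n)
    where
      indicator : ∀ b → (if b then 1 else 0) ×ᴿ 1# ≈ (if b then 1# else 0#)
      indicator true = +-identityʳ 1#
      indicator false = refl
      go : ∀ xs → ∑.fold xs (λ u → if C u then 1# else 0#) ≈ ℕ∑.fold xs (λ u → if C u then 1 else 0) ×ᴿ 1#
      go [] = refl
      go (u ∷ xs) = sym (trans (×-homo-+ 1# (if C u then 1 else 0) _) (+-cong (indicator (C u)) (sym (go xs))))

  card-* : ∀ {n} (C : Code n) z → card C * z ≈ ∑.fold (allVecs n) (λ w → if C w then z else 0#)
  card-* {n} C z = trans (∑-*ʳ (allVecs n) z _) (∑.fold-cong (allVecs n) λ w →
    trans (if-*ʳ (C w) 1# z) (if-cong (C w) (*-identityˡ z)))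

  2^k×1≈two^k : ∀ k → (2 ℕ.^ k) ×ᴿ 1# ≈ two ^ k
  2^k×1≈two^k zero = +-identityʳ 1#
  2^k×1≈two^k (suc k) = trans (×1-homo-* 2 (2 ℕ.^ k)) (*-cong (+-congˡ (+-identityʳ 1#)) (2^k×1≈two^k k))

  character-orthogonality : ∀ m (x : Vec Bool m) →
    ∑.fold (allVecs m) (λ b → χ (dot x b)) ≈ (if eqV x (zeros m) then two ^ m else 0#)
  character-orthogonality zero [] = +-identityʳ _
  character-orthogonality (suc m) (false ∷ x) = begin
    ∑.fold (allVecs (suc m)) (λ b → χ (dot (false ∷ x) b))
      ≈⟨ ∑.fold-allVecs-suc m _ ⟩
    ∑.fold (allVecs m) (λ v → χ (dot x v) + χ (dot x v))
      ≈⟨ ∑.fold-∙ (allVecs m) _ _ ⟩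
    ∑.fold (allVecs m) (λ v → χ (dot x v)) + ∑.fold (allVecs m) (λ v → χ (dot x v))
      ≈⟨ sym (two*x≈x+x _) ⟩
    two * ∑.fold (allVecs m) (λ v → χ (dot x v))
      ≈⟨ *-congˡ (character-orthogonality m x) ⟩
    two * (if eqV x (zeros m) then two ^ m else 0#)
      ≈⟨ if-*ˡ (eqV x (zeros m)) two _ ⟩
    (if eqV x (zeros m) then two ^ suc m else 0#) ∎
  character-orthogonality (suc m) (true ∷ x) = begin
    ∑.fold (allVecs (suc m)) (λ b → χ (dot (true ∷ x) b))
      ≈⟨ ∑.fold-allVecs-suc m _ ⟩
    ∑.fold (allVecs m) (λ v → χ (dot x v) + χ (not (dot x v)))
      ≈⟨ ∑.fold-cong (allVecs m) (λ v → trans (+-congˡ (χ-not (dot x v))) (-‿inverseʳ _)) ⟩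
    ∑.fold (allVecs m) (λ v → 0#)
      ≈⟨ ∑.fold-ε (allVecs m) ⟩
    0# ∎

  character-orthogonality₂ : ∀ m (a d : Vec Bool m) →
    ∑.fold (allVecs m) (λ b → χ (dot a b) * χ (dot b d)) ≈ (if eqV a d then two ^ m else 0#)
  character-orthogonality₂ m a d = begin
    ∑.fold (allVecs m) (λ b → χ (dot a b) * χ (dot b d))
      ≈⟨ ∑.fold-cong (allVecs m) (λ b → trans (sym (χ-xor _ _)) (reflexive (≡.cong χ
           (≡.trans (≡.cong (dot a b xor_) (dot-comm b d)) (≡.sym (dot-addˡ a d b)))))) ⟩
    ∑.fold (allVecs m) (λ b → χ (dot (addV a d) b))
      ≈⟨ character-orthogonality m (addV a d) ⟩
    (if eqV (addV a d) (zeros m) then two ^ m else 0#)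
      ≡⟨ ≡.cong (λ t → if t then two ^ m else 0#) (eqV-addV-zeros a d) ⟩
    (if eqV a d then two ^ m else 0#) ∎

module SelfDualSums {c ℓ : Level} (R : CommutativeRing c ℓ) (2-torsion-free : 2-TorsionFree R)
  {n : ℕ} {C : Code n} (sd : IsSelfDual C) where
  open CommutativeRing R
  open RingSums R
  open SelfDual sd
  open SetoidReasoning setoid

  codeCharacter : Vec Bool n → Vec Bool n → Carrier
  codeCharacter w u = if C u then χ (dot u w) else 0#

  codeCharacter-sum : ∀ w → ∑.fold (allVecs n) (codeCharacter w) ≈ (if C w then card C else 0#)
  codeCharacter-sum w with C w in Cw≡
  ... | true = ∑.fold-cong (allVecs n) trivial-on-C
    where
      trivial-on-C : ∀ u → codeCharacter w u ≈ (if C u then 1# else 0#)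
      trivial-on-C u with C u in u∈C
      ... | true  = reflexive (≡.cong χ (≡.trans (dot-comm u w) (proj₁ (sd w) Cw≡ u u∈C)))
      ... | false = refl
  ... | false with ∉C⇒nonorthogonal Cw≡
  ...   | c , c∈C , w·c≡1 = 2-torsion-free _ (trans (+-congˡ S≈-S) (-‿inverseʳ _))
    where
      S = ∑.fold (allVecs n) (codeCharacter w)

      shift-negates : ∀ u → codeCharacter w (addV u c) ≈ - codeCharacter w u
      shift-negates u rewrite C-addV-invariant u c∈C with C u
      ... | true  = trans (reflexive (≡.cong χ flips)) (χ-not (dot u w))
        where
          flips : dot (addV u c) w ≡ not (dot u w)
          flips = ≡.trans (dot-addˡ u c w)
            (≡.trans (≡.cong (dot u w xor_) (≡.trans (dot-comm c w) w·c≡1)) (xor-comm (dot u w) true))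
      ... | false = sym -0#≈0#

      S≈-S : S ≈ - S
      S≈-S = begin
        S                                                        ≈⟨ ∑.fold-allVecs-translate n c _ ⟨
        ∑.fold (allVecs n) (λ u → codeCharacter w (addV u c))    ≈⟨ ∑.fold-cong (allVecs n) shift-negates ⟩
        ∑.fold (allVecs n) (λ u → - codeCharacter w u)           ≈⟨ ∑-neg (allVecs n) _ ⟩
        - S                                                      ∎

  card²≈2^n : card C * card C ≈ two ^ n
  card²≈2^n = begin
    card C * card C
      ≈⟨ card-* C (card C) ⟩
    ∑.fold (allVecs n) (λ w → if C w then card C else 0#)
      ≈⟨ ∑.fold-cong (allVecs n) (λ w → sym (codeCharacter-sum w)) ⟩
    ∑.fold (allVecs n) (λ w → ∑.fold (allVecs n) (codeCharacter w))
      ≈⟨ ∑.fold-swap (allVecs n) (allVecs n) _ ⟩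
    ∑.fold (allVecs n) (λ u → ∑.fold (allVecs n) (λ w → codeCharacter w u))
      ≈⟨ ∑.fold-cong (allVecs n) column-sum ⟩
    ∑.fold (allVecs n) (λ u → if eqV (zeros n) u then (if C u then two ^ n else 0#) else 0#)
      ≈⟨ ∑.allVecs-sifts n (zeros n) _ ⟩
    (if C (zeros n) then two ^ n else 0#)
      ≡⟨ ≡.cong (λ b → if b then two ^ n else 0#) zeros∈C ⟩
    two ^ n ∎
    where
      column-sum : ∀ u → ∑.fold (allVecs n) (λ w → codeCharacter w u)
                         ≈ (if eqV (zeros n) u then (if C u then two ^ n else 0#) else 0#)
      column-sum u with C u
      ... | true  = trans (character-orthogonality n u) (reflexive (≡.cong (λ b → if b then two ^ n else 0#) (eqV-sym u (zeros n))))
      ... | false with eqV (zeros n) u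
      ...   | true  = ∑.fold-ε (allVecs n)
      ...   | false = ∑.fold-ε (allVecs n)

  tupleCharacter-sum : ∀ g (ws : Vec (Vec Bool n) g) →
    ∑.fold (allTuples g n) (λ us → if allIn C us then χ (tupleDot us ws) else 0#) ≈ (if allIn C ws then card C ^ g else 0#)
  tupleCharacter-sum zero [] = +-identityʳ 1#
  tupleCharacter-sum (suc g) (w ∷ ws) = begin
    ∑.fold (allTuples (suc g) n) (λ us → if allIn C us then χ (tupleDot us (w ∷ ws)) else 0#)
      ≈⟨ ∑.fold-allTuples-suc g n _ ⟩
    ∑.fold (allTuples g n) (λ us → ∑.fold (allVecs n) (λ u → if C u ∧ allIn C us then χ (dot u w xor tupleDot us ws) else 0#))
      ≈⟨ ∑.fold-cong (allTuples g n) (λ us → ∑.fold-cong (allVecs n) (λ u → factor u us)) ⟩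
    ∑.fold (allTuples g n) (λ us → ∑.fold (allVecs n) (λ u → codeCharacter w u * rest us))
      ≈⟨ ∑.fold-cong (allTuples g n) (λ us → sym (∑-*ʳ (allVecs n) _ (codeCharacter w))) ⟩
    ∑.fold (allTuples g n) (λ us → ∑.fold (allVecs n) (codeCharacter w) * rest us)
      ≈⟨ sym (∑-*ˡ (allTuples g n) _ rest) ⟩
    ∑.fold (allVecs n) (codeCharacter w) * ∑.fold (allTuples g n) rest
      ≈⟨ *-cong (codeCharacter-sum w) (tupleCharacter-sum g ws) ⟩
    (if C w then card C else 0#) * (if allIn C ws then card C ^ g else 0#)
      ≈⟨ if-∧-* (C w) (allIn C ws) ⟨
    (if C w ∧ allIn C ws then card C * card C ^ g else 0#) ∎
    where
      rest : Vec (Vec Bool n) g → Carrier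
      rest us = if allIn C us then χ (tupleDot us ws) else 0#

      if-∧-* : ∀ a b {x y} → (if a ∧ b then x * y else 0#) ≈ (if a then x else 0#) * (if b then y else 0#)
      if-∧-* true true = refl
      if-∧-* true false = sym (zeroʳ _)
      if-∧-* false b = sym (zeroˡ _)

      factor : ∀ u us → (if C u ∧ allIn C us then χ (dot u w xor tupleDot us ws) else 0#) ≈ codeCharacter w u * rest us
      factor u us = trans (if-cong (C u ∧ allIn C us) (χ-xor (dot u w) (tupleDot us ws))) (if-∧-* (C u) (allIn C us))

module ColumnSums {c ℓ : Level} (R : CommutativeRing c ℓ) where
  open CommutativeRing R
  open RingSums R
  open SetoidReasoning setoid

  ∏∑≈∑∏ : ∀ g n (h : Fin n → Vec Bool g → Carrier) →
    ∏.fold (List.allFin n) (λ i → ∑.fold (allVecs g) (h i))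
    ≈ ∑.fold (allTuples g n) (λ ws → ∏.fold (List.allFin n) (λ i → h i (column ws i)))
  ∏∑≈∑∏ g zero h = sym (∑.fold-allTuples-zero g (λ _ → 1#))
  ∏∑≈∑∏ g (suc n) h = begin
    ∏.fold (List.allFin (suc n)) (λ i → ∑.fold (allVecs g) (h i))
      ≡⟨ ∏.fold-allFin-suc n _ ⟩
    ∑.fold (allVecs g) (h Fin.zero) * ∏.fold (List.allFin n) (λ i → ∑.fold (allVecs g) (h (Fin.suc i)))
      ≈⟨ *-congˡ (∏∑≈∑∏ g n (λ i → h (Fin.suc i))) ⟩
    ∑.fold (allVecs g) (h Fin.zero) * ∑.fold (allTuples g n) (λ ws → tail-product ws)
      ≈⟨ ∑-*ʳ (allVecs g) _ _ ⟩
    ∑.fold (allVecs g) (λ b → h Fin.zero b * ∑.fold (allTuples g n) tail-product)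
      ≈⟨ ∑.fold-cong (allVecs g) (λ b → ∑-*ˡ (allTuples g n) _ _) ⟩
    ∑.fold (allVecs g) (λ b → ∑.fold (allTuples g n) (λ ws → h Fin.zero b * tail-product ws))
      ≈⟨ ∑.fold-cong (allVecs g) (λ b → ∑.fold-cong (allTuples g n) (λ ws → sym (split b ws))) ⟩
    ∑.fold (allVecs g) (λ b → ∑.fold (allTuples g n) (λ ws → product (consColumn b ws)))
      ≈⟨ ∑.fold-allTuples-byColumn g n product ⟨
    ∑.fold (allTuples g (suc n)) product ∎
    where
      tail-product : Vec (Vec Bool n) g → Carrier
      tail-product ws = ∏.fold (List.allFin n) (λ i → h (Fin.suc i) (column ws i))
      product : Vec (Vec Bool (suc n)) g → Carrier
      product ws = ∏.fold (List.allFin (suc n)) (λ i → h i (column ws i))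
      split : ∀ b ws → product (consColumn b ws) ≈ h Fin.zero b * tail-product ws
      split b ws = trans (reflexive (∏.fold-allFin-suc n _))
        (*-cong (reflexive (≡.cong (h Fin.zero) (column-consColumn-zero b ws)))
                (∏.fold-cong (List.allFin n) (λ i → reflexive (≡.cong (h (Fin.suc i)) (column-consColumn-suc b ws i)))))

  ∏χ∧≈χdot : ∀ n (u w : Vec Bool n) → ∏.fold (List.allFin n) (λ i → χ (lookup u i ∧ lookup w i)) ≈ χ (dot u w)
  ∏χ∧≈χdot zero [] [] = refl
  ∏χ∧≈χdot (suc n) (x ∷ u) (y ∷ w) =
    trans (reflexive (∏.fold-allFin-suc n _)) (trans (*-congˡ (∏χ∧≈χdot n u w)) (sym (χ-xor _ _)))

  ∏χ-columns≈χ-tupleDot : ∀ g n (us ws : Vec (Vec Bool n) g) →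
    ∏.fold (List.allFin n) (λ i → χ (dot (column us i) (column ws i))) ≈ χ (tupleDot us ws)
  ∏χ-columns≈χ-tupleDot zero n [] [] = ∏.fold-ε (List.allFin n)
  ∏χ-columns≈χ-tupleDot (suc g) n (u ∷ us) (w ∷ ws) = begin
    ∏.fold (List.allFin n) (λ i → χ ((lookup u i ∧ lookup w i) xor dot (column us i) (column ws i)))
      ≈⟨ ∏.fold-cong (List.allFin n) (λ i → χ-xor (lookup u i ∧ lookup w i) _) ⟩
    ∏.fold (List.allFin n) (λ i → χ (lookup u i ∧ lookup w i) * χ (dot (column us i) (column ws i)))
      ≈⟨ ∏.fold-∙ (List.allFin n) _ _ ⟩
    ∏.fold (List.allFin n) (λ i → χ (lookup u i ∧ lookup w i)) * ∏.fold (List.allFin n) (λ i → χ (dot (column us i) (column ws i)))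
      ≈⟨ *-cong (∏χ∧≈χdot n u w) (∏χ-columns≈χ-tupleDot g n us ws) ⟩
    χ (dot u w) * χ (tupleDot us ws)
      ≈⟨ χ-xor (dot u w) (tupleDot us ws) ⟨
    χ (dot u w xor tupleDot us ws) ∎

m*m≡n*n⇒m≡n : ∀ {m n} → m ℕ.* m ≡ n ℕ.* n → m ≡ n
m*m≡n*n⇒m≡n {m} {n} eq with ℕ.<-cmp m n
... | tri≈ _ m≡n _ = m≡n
... | tri< m<n _ _ = ⊥-elim (ℕ.<-irrefl eq (ℕ.*-mono-< m<n m<n))
... | tri> _ _ n<m = ⊥-elim (ℕ.<-irrefl (≡.sym eq) (ℕ.*-mono-< n<m n<m))

module ℤSums = RingSums ℤ.+-*-commutativeRing

ℤ-2-torsion-free : 2-TorsionFree ℤ.+-*-commutativeRing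
ℤ-2-torsion-free (+ zero) _ = ≡.refl

×1≡+ : ∀ k → k ℤSums.×ᴿ + 1 ≡ + k
×1≡+ zero = ≡.refl
×1≡+ (suc k) = ≡.cong (λ z → + 1 ℤ.+ z) (×1≡+ k)

-- Unlike a general ring, ℤ lets the identity card C * card C ≈ 2^n determine card C.
size²≡2^n : ∀ {n} {C : Code n} → IsSelfDual C → size C ℕ.* size C ≡ 2 ℕ.^ n
size²≡2^n {n} {C} sd = ℤ.+-injective (begin
  + (size C ℕ.* size C)                 ≡⟨ ℤ.pos-* (size C) (size C) ⟩
  + size C ℤ.* + size C                 ≡⟨ ≡.cong₂ ℤ._*_ card≡size card≡size ⟨
  ℤSums.card C ℤ.* ℤSums.card C          ≡⟨ ℤSelfDual.card²≈2^n ⟩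
  ℤSums.two ℤSums.^ n                   ≡⟨ ℤSums.2^k×1≈two^k n ⟨
  (2 ℕ.^ n) ℤSums.×ᴿ + 1                ≡⟨ ×1≡+ (2 ℕ.^ n) ⟩
  + (2 ℕ.^ n)                           ∎)
  where
    open ≡.≡-Reasoning
    module ℤSelfDual = SelfDualSums ℤ.+-*-commutativeRing ℤ-2-torsion-free sd
    card≡size : ℤSums.card C ≡ + size C
    card≡size = ≡.trans (ℤSums.card≈size×1 C) (×1≡+ (size C))

size≡2^half : ∀ {n k} {C : Code n} → IsSelfDual C → n ≡ 2 ℕ.* k → size C ≡ 2 ℕ.^ k
size≡2^half {n} {k} {C} sd n≡2k = m*m≡n*n⇒m≡n (begin
  size C ℕ.* size C         ≡⟨ size²≡2^n sd ⟩
  2 ℕ.^ n                   ≡⟨ ≡.cong (2 ℕ.^_) (≡.trans n≡2k (≡.cong (k ℕ.+_) (ℕ.+-identityʳ k))) ⟩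
  2 ℕ.^ (k ℕ.+ k)           ≡⟨ ℕ.^-distribˡ-+-* 2 k k ⟩
  2 ℕ.^ k ℕ.* 2 ℕ.^ k       ∎)
  where open ≡.≡-Reasoning

module GaussSums {c ℓ : Level} (R : CommutativeRing c ℓ) (ζ half : CommutativeRing.Carrier R)
  (ζ⁴≈-1 : IsRootOfX⁴+1 R ζ) (two*half≈1 : IsHalf R half) where
  open CommutativeRing R
  open RingSums R
  open Over R ζ half using (iR)
  open SetoidReasoning setoid
  open CMSolver *-commutativeMonoid using (solve; _⊕_; _⊜_) renaming (id to one)

  four : Carrier
  four = two * two

  four*quarter≈1 : four * (half * half) ≈ 1#
  four*quarter≈1 = trans (interchange two two half half) (trans (*-cong two*half≈1 two*half≈1) (*-identityˡ 1#))
    where open CommutativeSemigroupProperties *-commutativeSemigroup using (interchange)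

  1^n≈1 : ∀ n → 1# ^ n ≈ 1#
  1^n≈1 zero = refl
  1^n≈1 (suc n) = trans (*-identityˡ _) (1^n≈1 n)

  ^-inverse : ∀ {x y} → x * y ≈ 1# → ∀ n → x ^ n * y ^ n ≈ 1#
  ^-inverse {x} {y} xy≈1 n = trans (sym (^-distrib-* x y n)) (trans (^-congˡ n xy≈1) (1^n≈1 n))

  x^4≈x²*x² : ∀ x → x ^ 4 ≈ (x * x) * (x * x)
  x^4≈x²*x² = solve 1 (λ z → z ⊕ (z ⊕ (z ⊕ (z ⊕ one))) ⊜ (z ⊕ z) ⊕ (z ⊕ z)) refl

  i*i≈-1 : iR * iR ≈ - 1#
  i*i≈-1 = trans (solve 1 (λ z → (z ⊕ z) ⊕ (z ⊕ z) ⊜ ((z ⊕ z) ⊕ z) ⊕ z) refl ζ) ζ⁴≈-1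

  ζ^4≈-1 : ζ ^ 4 ≈ - 1#
  ζ^4≈-1 = trans (solve 1 (λ z → z ⊕ (z ⊕ (z ⊕ (z ⊕ one))) ⊜ ((z ⊕ z) ⊕ z) ⊕ z) refl ζ) ζ⁴≈-1

  [1+i]²≈two*i : (1# + iR) * (1# + iR) ≈ two * iR
  [1+i]²≈two*i = begin
    (1# + iR) * (1# + iR)              ≈⟨ distribʳ _ 1# iR ⟩
    1# * (1# + iR) + iR * (1# + iR)    ≈⟨ +-cong (*-identityˡ _) (distribˡ iR 1# iR) ⟩
    (1# + iR) + (iR * 1# + iR * iR)    ≈⟨ +-congˡ (+-cong (*-identityʳ iR) i*i≈-1) ⟩
    (1# + iR) + (iR + - 1#)            ≈⟨ +-congʳ (+-comm 1# iR) ⟩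
    (iR + 1#) + (iR + - 1#)            ≈⟨ +-assoc iR 1# _ ⟩
    iR + (1# + (iR + - 1#))            ≈⟨ +-congˡ (x+[y+-x]≈y 1# iR) ⟩
    iR + iR                            ≈⟨ two*x≈x+x iR ⟨
    two * iR                           ∎
    where
      x+[y+-x]≈y : ∀ x y → x + (y + - x) ≈ y
      x+[y+-x]≈y x y = trans (+-congˡ (+-comm y (- x))) (trans (sym (+-assoc x (- x) y))
                         (trans (+-congʳ (-‿inverseʳ x)) (+-identityˡ y)))

  [1+i]^4≈-four : (1# + iR) ^ 4 ≈ - four
  [1+i]^4≈-four = begin
    (1# + iR) ^ 4                                      ≈⟨ x^4≈x²*x² (1# + iR) ⟩
    ((1# + iR) * (1# + iR)) * ((1# + iR) * (1# + iR))  ≈⟨ *-cong [1+i]²≈two*i [1+i]²≈two*i ⟩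
    (two * iR) * (two * iR)                            ≈⟨ interchange two iR two iR ⟩
    four * (iR * iR)                                   ≈⟨ *-congˡ i*i≈-1 ⟩
    four * - 1#                                        ≈⟨ -‿distribʳ-* four 1# ⟨
    - (four * 1#)                                      ≈⟨ -‿cong (*-identityʳ four) ⟩
    - four                                             ∎
    where open CommutativeSemigroupProperties *-commutativeSemigroup using (interchange)

  κ : Carrier
  κ = half * (1# + iR)

  κ*κ*two≈i : κ * κ * two ≈ iR
  κ*κ*two≈i = begin
    κ * κ * two                                     ≈⟨ *-congʳ (interchange half (1# + iR) half (1# + iR)) ⟩
    ((half * half) * ((1# + iR) * (1# + iR))) * two ≈⟨ *-congʳ (*-congˡ [1+i]²≈two*i) ⟩
    ((half * half) * (two * iR)) * two
      ≈⟨ solve 3 (λ h t i → ((h ⊕ h) ⊕ (t ⊕ i)) ⊕ t ⊜ ((t ⊕ h) ⊕ (t ⊕ h)) ⊕ i) refl half two iR ⟩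
    ((two * half) * (two * half)) * iR              ≈⟨ *-congʳ (trans (*-cong two*half≈1 two*half≈1) (*-identityˡ 1#)) ⟩
    1# * iR                                         ≈⟨ *-identityˡ iR ⟩
    iR                                              ∎
    where open CommutativeSemigroupProperties *-commutativeSemigroup using (interchange)

  iWeight : ∀ {k} → Vec Bool k → Carrier
  iWeight x = iR ^ weight x

  iWeight-addV : ∀ {k} (x y : Vec Bool k) → iWeight (addV x y) ≈ (iWeight x * iWeight y) * χ (dot x y)
  iWeight-addV [] [] = sym (trans (*-identityʳ _) (*-identityʳ _))
  iWeight-addV (false ∷ x) (false ∷ y) = iWeight-addV x y
  iWeight-addV (true ∷ x) (false ∷ y) = trans (*-congˡ (iWeight-addV x y))
    (solve 4 (λ i a b d → i ⊕ ((a ⊕ b) ⊕ d) ⊜ ((i ⊕ a) ⊕ b) ⊕ d) refl iR (iWeight x) (iWeight y) (χ (dot x y)))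
  iWeight-addV (false ∷ x) (true ∷ y) = trans (*-congˡ (iWeight-addV x y))
    (solve 4 (λ i a b d → i ⊕ ((a ⊕ b) ⊕ d) ⊜ (a ⊕ (i ⊕ b)) ⊕ d) refl iR (iWeight x) (iWeight y) (χ (dot x y)))
  iWeight-addV (true ∷ x) (true ∷ y) = begin
    iWeight (addV x y)                                    ≈⟨ iWeight-addV x y ⟩
    (iWeight x * iWeight y) * χ (dot x y)                 ≈⟨ *-identityˡ _ ⟨
    1# * ((iWeight x * iWeight y) * χ (dot x y))          ≈⟨ *-congʳ (trans (*-congʳ i*i≈-1) -1*-1≈1) ⟨
    ((iR * iR) * - 1#) * ((iWeight x * iWeight y) * χ (dot x y))
      ≈⟨ solve 5 (λ i m a b d → ((i ⊕ i) ⊕ m) ⊕ ((a ⊕ b) ⊕ d) ⊜ ((i ⊕ a) ⊕ (i ⊕ b)) ⊕ (m ⊕ d))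
                 refl iR (- 1#) (iWeight x) (iWeight y) (χ (dot x y)) ⟩
    ((iR * iWeight x) * (iR * iWeight y)) * (- 1# * χ (dot x y))
      ≈⟨ *-congˡ (trans (-1*x≈-x _) (sym (χ-not (dot x y)))) ⟩
    ((iR * iWeight x) * (iR * iWeight y)) * χ (not (dot x y)) ∎

  iWeight≈1 : ∀ {k} (x : Vec Bool k) → 4 ∣ weight x → iWeight x ≈ 1#
  iWeight≈1 x (divides q weight≡q*4) = begin
    iR ^ weight x       ≡⟨ ≡.cong (iR ^_) (≡.trans weight≡q*4 (ℕ.*-comm q 4)) ⟩
    iR ^ (4 ℕ.* q)      ≈⟨ ^-assocʳ iR 4 q ⟨
    (iR ^ 4) ^ q        ≈⟨ ^-congˡ q i^4≈1 ⟩
    1# ^ q              ≈⟨ 1^n≈1 q ⟩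
    1#                  ∎
    where
      i^4≈1 : iR ^ 4 ≈ 1#
      i^4≈1 = trans (x^4≈x²*x² iR) (trans (*-cong i*i≈-1 i*i≈-1) -1*-1≈1)

  ∏-iWeight : ∀ {k} (u : Vec Bool k) → ∏.fold (List.allFin k) (λ i → if lookup u i then iR else 1#) ≈ iWeight u
  ∏-iWeight [] = refl
  ∏-iWeight {suc k} (true ∷ u) = trans (reflexive (∏.fold-allFin-suc k _)) (*-congˡ (∏-iWeight u))
  ∏-iWeight {suc k} (false ∷ u) = trans (reflexive (∏.fold-allFin-suc k _)) (trans (*-identityˡ _) (∏-iWeight u))

  gauss-sum : ∀ k → ∑.fold (allVecs k) iWeight ≈ (1# + iR) ^ k
  gauss-sum zero = +-identityʳ 1#
  gauss-sum (suc k) = begin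
    ∑.fold (allVecs (suc k)) iWeight                ≈⟨ ∑.fold-allVecs-suc k iWeight ⟩
    ∑.fold (allVecs k) (λ v → iWeight v + iR * iWeight v)
      ≈⟨ ∑.fold-cong (allVecs k) (λ v → trans (distribʳ _ 1# iR) (+-congʳ (*-identityˡ _))) ⟨
    ∑.fold (allVecs k) (λ v → (1# + iR) * iWeight v) ≈⟨ ∑-*ˡ (allVecs k) _ iWeight ⟨
    (1# + iR) * ∑.fold (allVecs k) iWeight          ≈⟨ *-congˡ (gauss-sum k) ⟩
    (1# + iR) * (1# + iR) ^ k                       ∎

  2-torsion-free : ∀ x → x + x ≈ 0# → x ≈ 0#
  2-torsion-free x x+x≈0 = begin
    x                   ≈⟨ *-identityˡ x ⟨
    1# * x              ≈⟨ *-congʳ (trans (*-comm half two) two*half≈1) ⟨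
    (half * two) * x    ≈⟨ *-assoc half two x ⟩
    half * (two * x)    ≈⟨ *-congˡ (trans (two*x≈x+x x) x+x≈0) ⟩
    half * 0#           ≈⟨ zeroʳ half ⟩
    0#                  ∎

  module TypeIIGauss {n : ℕ} {C : Code n} (typeII : IsTypeII C) where
    open TypeII typeII
    open SelfDualSums R 2-torsion-free (proj₁ typeII)

    iWeight-shift : ∀ x {c} → C c ≡ true → iWeight (addV x c) ≈ iWeight x * χ (dot c x)
    iWeight-shift x {c} c∈C = begin
      iWeight (addV x c)                      ≈⟨ iWeight-addV x c ⟩
      (iWeight x * iWeight c) * χ (dot x c)   ≈⟨ *-congʳ (trans (*-congˡ (iWeight≈1 c (proj₂ typeII c c∈C))) (*-identityʳ _)) ⟩
      iWeight x * χ (dot x c)                 ≡⟨ ≡.cong (λ d → iWeight x * χ d) (dot-comm x c) ⟩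
      iWeight x * χ (dot c x)                 ∎

    card*gauss≈card² : card C * ∑.fold (allVecs n) iWeight ≈ card C * card C
    card*gauss≈card² = begin
      card C * ∑.fold (allVecs n) iWeight
        ≈⟨ card-* C _ ⟩
      ∑.fold (allVecs n) (λ c → if C c then ∑.fold (allVecs n) iWeight else 0#)
        ≈⟨ ∑.fold-cong (allVecs n) (λ c → if-cong (C c) (sym (translate c))) ⟩
      ∑.fold (allVecs n) (λ c → if C c then ∑.fold (allVecs n) (λ x → iWeight (addV x c)) else 0#)
        ≈⟨ ∑.fold-cong (allVecs n) (λ c → sym (∑.fold-if (allVecs n) (C c) _)) ⟩
      ∑.fold (allVecs n) (λ c → ∑.fold (allVecs n) (λ x → if C c then iWeight (addV x c) else 0#))
        ≈⟨ ∑.fold-swap (allVecs n) (allVecs n) _ ⟩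
      ∑.fold (allVecs n) (λ x → ∑.fold (allVecs n) (λ c → if C c then iWeight (addV x c) else 0#))
        ≈⟨ ∑.fold-cong (allVecs n) (λ x → ∑.fold-cong (allVecs n) (shifted x)) ⟩
      ∑.fold (allVecs n) (λ x → ∑.fold (allVecs n) (λ c → iWeight x * codeCharacter x c))
        ≈⟨ ∑.fold-cong (allVecs n) (λ x → sym (∑-*ˡ (allVecs n) (iWeight x) _)) ⟩
      ∑.fold (allVecs n) (λ x → iWeight x * ∑.fold (allVecs n) (codeCharacter x))
        ≈⟨ ∑.fold-cong (allVecs n) (λ x → *-congˡ (codeCharacter-sum x)) ⟩
      ∑.fold (allVecs n) (λ x → iWeight x * (if C x then card C else 0#))
        ≈⟨ ∑.fold-cong (allVecs n) trivial-on-C ⟩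
      ∑.fold (allVecs n) (λ x → if C x then card C else 0#)
        ≈⟨ card-* C (card C) ⟨
      card C * card C ∎
      where
        translate : ∀ c → ∑.fold (allVecs n) (λ x → iWeight (addV x c)) ≈ ∑.fold (allVecs n) iWeight
        translate c = ∑.fold-allVecs-translate n c iWeight

        shifted : ∀ x c → (if C c then iWeight (addV x c) else 0#) ≈ iWeight x * codeCharacter x c
        shifted x c with C c in c∈C
        ... | true  = iWeight-shift x c∈C
        ... | false = sym (zeroʳ _)

        trivial-on-C : ∀ x → iWeight x * (if C x then card C else 0#) ≈ (if C x then card C else 0#)
        trivial-on-C x with C x in x∈C
        ... | true  = trans (*-congʳ (iWeight≈1 x (proj₂ typeII x x∈C))) (*-identityˡ _)
        ... | false = zeroʳ _

    card*card*half^n≈1 : card C * (card C * half ^ n) ≈ 1#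
    card*card*half^n≈1 = trans (sym (*-assoc _ _ _)) (trans (*-congʳ card²≈2^n) (^-inverse two*half≈1 n))

    gauss-sum≈card : (1# + iR) ^ n ≈ card C
    gauss-sum≈card = begin
      (1# + iR) ^ n                    ≈⟨ gauss-sum n ⟨
      S                                ≈⟨ *-identityˡ S ⟨
      1# * S                           ≈⟨ *-congʳ (trans (*-comm _ _) card*card*half^n≈1) ⟨
      (inv * card C) * S               ≈⟨ *-assoc inv _ S ⟩
      inv * (card C * S)               ≈⟨ *-congˡ card*gauss≈card² ⟩
      inv * (card C * card C)          ≈⟨ *-assoc inv _ _ ⟨
      (inv * card C) * card C          ≈⟨ *-congʳ (trans (*-comm _ _) card*card*half^n≈1) ⟩
      1# * card C                      ≈⟨ *-identityˡ _ ⟩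
      card C                           ∎
      where
        S = ∑.fold (allVecs n) iWeight
        inv = card C * half ^ n

    κ^n*card≈1 : κ ^ n * card C ≈ 1#
    κ^n*card≈1 = begin
      κ ^ n * card C                           ≈⟨ *-congʳ (^-distrib-* half (1# + iR) n) ⟩
      (half ^ n * (1# + iR) ^ n) * card C      ≈⟨ *-assoc _ _ _ ⟩
      half ^ n * ((1# + iR) ^ n * card C)      ≈⟨ *-congˡ (*-congʳ gauss-sum≈card) ⟩
      half ^ n * (card C * card C)             ≈⟨ *-congˡ card²≈2^n ⟩
      half ^ n * two ^ n                       ≈⟨ *-comm _ _ ⟩
      two ^ n * half ^ n                       ≈⟨ ^-inverse two*half≈1 n ⟩
      1#                                       ∎

    card≈four^q : ∀ {q} → n ≡ 4 ℕ.* q → card C ≈ four ^ q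
    card≈four^q {q} n≡4q = begin
      card C                    ≈⟨ card≈size×1 C ⟩
      size C ×ᴿ 1#              ≡⟨ ≡.cong (_×ᴿ 1#) (size≡2^half {k = 2 ℕ.* q} (proj₁ typeII) n≡2[2q]) ⟩
      (2 ℕ.^ (2 ℕ.* q)) ×ᴿ 1#   ≈⟨ 2^k×1≈two^k (2 ℕ.* q) ⟩
      two ^ (2 ℕ.* q)           ≈⟨ ^-assocʳ two 2 q ⟨
      (two ^ 2) ^ q             ≈⟨ ^-congˡ q (*-congˡ (*-identityʳ two)) ⟩
      four ^ q                  ∎
      where n≡2[2q] = ≡.trans n≡4q (ℕ.*-assoc 2 2 q)

    -- 8 ∣ n in disguise: (1+i)^n = card C = 4^q, while (1+i)^4 = -4.
    [-1]^q≈1 : ∀ {q} → n ≡ 4 ℕ.* q → (- 1#) ^ q ≈ 1#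
    [-1]^q≈1 {q} n≡4q = begin
      (- 1#) ^ q                                ≈⟨ *-identityʳ _ ⟨
      (- 1#) ^ q * 1#                           ≈⟨ *-congˡ (^-inverse four*quarter≈1 q) ⟨
      (- 1#) ^ q * (four ^ q * quarter ^ q)     ≈⟨ *-assoc _ _ _ ⟨
      ((- 1#) ^ q * four ^ q) * quarter ^ q     ≈⟨ *-congʳ (^-distrib-* (- 1#) four q) ⟨
      (- 1# * four) ^ q * quarter ^ q           ≈⟨ *-congʳ (^-congˡ q (-1*x≈-x four)) ⟩
      (- four) ^ q * quarter ^ q                ≈⟨ *-congʳ -four^q≈four^q ⟩
      four ^ q * quarter ^ q                    ≈⟨ ^-inverse four*quarter≈1 q ⟩
      1#                                        ∎
      where
        quarter = half * half
        -four^q≈four^q : (- four) ^ q ≈ four ^ q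
        -four^q≈four^q = begin
          (- four) ^ q           ≈⟨ ^-congˡ q [1+i]^4≈-four ⟨
          ((1# + iR) ^ 4) ^ q    ≈⟨ ^-assocʳ (1# + iR) 4 q ⟩
          (1# + iR) ^ (4 ℕ.* q)  ≡⟨ ≡.cong ((1# + iR) ^_) n≡4q ⟨
          (1# + iR) ^ n          ≈⟨ gauss-sum≈card ⟩
          card C                 ≈⟨ card≈four^q {q} n≡4q ⟩
          four ^ q               ∎

    ζ^n≈1 : ζ ^ n ≈ 1#
    ζ^n≈1 with 4∣n
    ... | divides q n≡q*4 = begin
      ζ ^ n            ≡⟨ ≡.cong (ζ ^_) n≡4q ⟩
      ζ ^ (4 ℕ.* q)    ≈⟨ ^-assocʳ ζ 4 q ⟨
      (ζ ^ 4) ^ q      ≈⟨ ^-congˡ q ζ^4≈-1 ⟩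
      (- 1#) ^ q       ≈⟨ [-1]^q≈1 {q} n≡4q ⟩
      1#               ∎
      where n≡4q = ≡.trans n≡q*4 (ℕ.*-comm q 4)

module Invariance {c ℓ : Level} (R : CommutativeRing c ℓ) (ζ half : CommutativeRing.Carrier R)
  (ζ⁴≈-1 : IsRootOfX⁴+1 R ζ) (two*half≈1 : IsHalf R half) where
  open CommutativeRing R
  open RingSums R
  open ColumnSums R
  open GaussSums R ζ half ζ⁴≈-1 two*half≈1
  open Over R ζ half
  open SetoidReasoning setoid
  open CMSolver *-commutativeMonoid using (solve; _⊕_; _⊜_)

  powR≡^ : ∀ x k → powR x k ≡ x ^ k
  powR≡^ x zero = ≡.refl
  powR≡^ x (suc k) = ≡.cong (x *_) (powR≡^ x k)

  act-congˡ : ∀ {g} {A B : Matrix g} → (∀ r s → A r s ≈ B r s) → ∀ v r → act A v r ≈ act B v r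
  act-congˡ {g} A≈B v r = ∑.fold-cong (allIx g) (λ k → *-congʳ (A≈B r k))

  act-congʳ : ∀ {g} (A : Matrix g) {v w : Point g} → (∀ r → v r ≈ w r) → ∀ r → act A v r ≈ act A w r
  act-congʳ {g} A v≈w r = ∑.fold-cong (allIx g) (λ k → *-congˡ (v≈w k))

  act-·ₘ : ∀ {g} (A B : Matrix g) v r → act (A ·ₘ B) v r ≈ act A (act B v) r
  act-·ₘ {g} A B v r = begin
    ∑.fold I (λ l → ∑.fold I (λ k → A r k * B k l) * v l)       ≈⟨ ∑.fold-cong I (λ l → ∑-*ʳ I (v l) _) ⟩
    ∑.fold I (λ l → ∑.fold I (λ k → (A r k * B k l) * v l))     ≈⟨ ∑.fold-swap I I _ ⟩
    ∑.fold I (λ k → ∑.fold I (λ l → (A r k * B k l) * v l))     ≈⟨ ∑.fold-cong I (λ k → ∑.fold-cong I (λ l → *-assoc _ _ _)) ⟩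
    ∑.fold I (λ k → ∑.fold I (λ l → A r k * (B k l * v l)))     ≈⟨ ∑.fold-cong I (λ k → ∑-*ˡ I (A r k) _) ⟨
    ∑.fold I (λ k → A r k * ∑.fold I (λ l → B k l * v l))       ∎
    where I = allIx g

  ∑-allIx : ∀ g (f : Ix g → Carrier) →
            ∑.fold (allIx g) f ≈ ∑.fold (allVecs g) (λ b → f (false , b)) + ∑.fold (allVecs g) (λ b → f (true , b))
  ∑-allIx g f = trans (∑.fold-++ (List.map (false ,_) (allVecs g)) _ f)
    (reflexive (≡.cong₂ _+_ (∑.fold-map {Y = Ix g} (false ,_) (allVecs g) f) (∑.fold-map {Y = Ix g} (true ,_) (allVecs g) f)))

  act-blockDiag : ∀ {g} (B : Vec Bool g → Vec Bool g → Carrier) v s a →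
                  act (blockDiag B) v (s , a) ≈ ∑.fold (allVecs g) (λ b → B a b * v (s , b))
  act-blockDiag {g} B v s a = trans (∑-allIx g _) (block s)
    where
      V = allVecs g
      off-block : ∀ t → ∑.fold V (λ b → 0# * v (t , b)) ≈ 0#
      off-block t = trans (∑.fold-cong V (λ b → zeroˡ _)) (∑.fold-ε V)
      block : ∀ s → ∑.fold V (λ b → blockDiag B (s , a) (false , b) * v (false , b))
                  + ∑.fold V (λ b → blockDiag B (s , a) (true , b) * v (true , b))
                  ≈ ∑.fold V (λ b → B a b * v (s , b))
      block false = trans (+-congˡ (off-block true)) (+-identityʳ _)
      block true = trans (+-congʳ (off-block false)) (+-identityˡ _)

  act-diagonal : ∀ {g} (d : Vec Bool g → Carrier) v s a →
                 act (blockDiag (λ a b → if eqV a b then d a else 0#)) v (s , a) ≈ d a * v (s , a)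
  act-diagonal {g} d v s a = begin
    act (blockDiag (λ a b → if eqV a b then d a else 0#)) v (s , a)
      ≈⟨ act-blockDiag (λ a b → if eqV a b then d a else 0#) v s a ⟩
    ∑.fold (allVecs g) (λ b → (if eqV a b then d a else 0#) * v (s , b))
      ≈⟨ ∑.fold-cong (allVecs g) (λ b → if-*ʳ (eqV a b) (d a) (v (s , b))) ⟩
    ∑.fold (allVecs g) (λ b → if eqV a b then d a * v (s , b) else 0#)
      ≈⟨ ∑.allVecs-sifts g a (λ b → d a * v (s , b)) ⟩
    d a * v (s , a) ∎

  act-scalar : ∀ {g} z (v : Point g) r → act (λ r k → if eqIx r k then z else 0#) v r ≈ z * v r
  act-scalar z v (s , a) = trans (act-congˡ (λ r k → reflexive (scalar-blockDiag r k)) v (s , a)) (act-diagonal (λ _ → z) v s a)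
    where
      scalar-blockDiag : ∀ r k → (if eqIx r k then z else 0#) ≡ blockDiag (λ a b → if eqV a b then z else 0#) r k
      scalar-blockDiag (false , a) (false , b) = ≡.refl
      scalar-blockDiag (false , a) (true , b) = ≡.refl
      scalar-blockDiag (true , a) (false , b) = ≡.refl
      scalar-blockDiag (true , a) (true , b) = ≡.refl

  act-idM : ∀ {g} (v : Point g) r → act idM v r ≈ v r
  act-idM v r = trans (act-scalar 1# v r) (*-identityˡ _)

  act-Mσ : ∀ {g} w (M : Vec (Vec Bool g) g) v s a → act (blockDiag (Mσ w M)) v (s , a) ≈ v (s , affine M w a)
  act-Mσ {g} w M v s a = begin
    act (blockDiag (Mσ w M)) v (s , a)
      ≈⟨ act-blockDiag (Mσ w M) v s a ⟩
    ∑.fold (allVecs g) (λ b → (if eqV b (affine M w a) then 1# else 0#) * v (s , b))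
      ≈⟨ ∑.fold-cong (allVecs g) (λ b → trans (if-*ʳ (eqV b (affine M w a)) 1# _)
           (reflexive (≡.cong (λ t → if t then 1# * v (s , b) else 0#) (eqV-sym b (affine M w a))))) ⟩
    ∑.fold (allVecs g) (λ b → if eqV (affine M w a) b then 1# * v (s , b) else 0#)
      ≈⟨ ∑.allVecs-sifts g (affine M w a) _ ⟩
    1# * v (s , affine M w a)
      ≈⟨ *-identityˡ _ ⟩
    v (s , affine M w a) ∎

  act-Tg² : ∀ {g} (u : Point g) r → act (blockDiag Tg) (act (blockDiag Tg) u) r ≈ iR ^ g * u r
  act-Tg² {g} u (s , a) = begin
    act (blockDiag Tg) (act (blockDiag Tg) u) (s , a)
      ≈⟨ act-blockDiag Tg _ s a ⟩
    ∑.fold V (λ b → Tg a b * act (blockDiag Tg) u (s , b))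
      ≈⟨ ∑.fold-cong V (λ b → *-congˡ (act-blockDiag Tg u s b)) ⟩
    ∑.fold V (λ b → Tg a b * ∑.fold V (λ d → Tg b d * u (s , d)))
      ≈⟨ ∑.fold-cong V (λ b → ∑-*ˡ V _ _) ⟩
    ∑.fold V (λ b → ∑.fold V (λ d → Tg a b * (Tg b d * u (s , d))))
      ≈⟨ ∑.fold-swap V V _ ⟩
    ∑.fold V (λ d → ∑.fold V (λ b → Tg a b * (Tg b d * u (s , d))))
      ≈⟨ ∑.fold-cong V (λ d → ∑.fold-cong V (λ b → solve 4 (λ k x y z → (k ⊕ x) ⊕ ((k ⊕ y) ⊕ z) ⊜ ((k ⊕ k) ⊕ z) ⊕ (x ⊕ y))
                                                          refl (powR κ g) (χ (dot a b)) (χ (dot b d)) (u (s , d)))) ⟩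
    ∑.fold V (λ d → ∑.fold V (λ b → ((powR κ g * powR κ g) * u (s , d)) * (χ (dot a b) * χ (dot b d))))
      ≈⟨ ∑.fold-cong V (λ d → sym (∑-*ˡ V _ _)) ⟩
    ∑.fold V (λ d → ((powR κ g * powR κ g) * u (s , d)) * ∑.fold V (λ b → χ (dot a b) * χ (dot b d)))
      ≈⟨ ∑.fold-cong V (λ d → trans (*-congˡ (character-orthogonality₂ g a d)) (if-*ˡ (eqV a d) _ _)) ⟩
    ∑.fold V (λ d → if eqV a d then ((powR κ g * powR κ g) * u (s , d)) * two ^ g else 0#)
      ≈⟨ ∑.allVecs-sifts g a _ ⟩
    ((powR κ g * powR κ g) * u (s , a)) * two ^ g
      ≈⟨ solve 3 (λ k x t → (k ⊕ x) ⊕ t ⊜ (k ⊕ t) ⊕ x) refl (powR κ g * powR κ g) (u (s , a)) (two ^ g) ⟩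
    ((powR κ g * powR κ g) * two ^ g) * u (s , a)
      ≈⟨ *-congʳ κ^g²*two^g≈i^g ⟩
    iR ^ g * u (s , a) ∎
    where
      V = allVecs g
      κ^g²*two^g≈i^g : (powR κ g * powR κ g) * two ^ g ≈ iR ^ g
      κ^g²*two^g≈i^g = begin
        (powR κ g * powR κ g) * two ^ g   ≡⟨ ≡.cong (λ x → (x * x) * two ^ g) (powR≡^ κ g) ⟩
        (κ ^ g * κ ^ g) * two ^ g         ≈⟨ *-congʳ (^-distrib-* κ κ g) ⟨
        (κ * κ) ^ g * two ^ g             ≈⟨ ^-distrib-* (κ * κ) two g ⟨
        (κ * κ * two) ^ g                 ≈⟨ ^-congˡ g κ*κ*two≈i ⟩
        iR ^ g                            ∎

  Surjective : ∀ {g} → Matrix g → Set (c ⊔ ℓ)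
  Surjective {g} τ = ∀ (u : Point g) → Σ (Point g) λ w → ∀ r → act τ w r ≈ u r

  i*-i≈1 : iR * - iR ≈ 1#
  i*-i≈1 = trans (sym (-‿distribʳ-* iR iR)) (trans (-‿cong i*i≈-1) (-‿involutive 1#))

  Tg-surjective : ∀ {g} → Surjective (blockDiag (Tg {g}))
  Tg-surjective {g} u = act (blockDiag Tg) (λ q → (- iR) ^ g * u q) , λ r → begin
    act (blockDiag Tg) (act (blockDiag Tg) (λ q → (- iR) ^ g * u q)) r   ≈⟨ act-Tg² _ r ⟩
    iR ^ g * ((- iR) ^ g * u r)                                          ≈⟨ *-assoc _ _ _ ⟨
    (iR ^ g * (- iR) ^ g) * u r                                          ≈⟨ *-congʳ (^-inverse i*-i≈1 g) ⟩
    1# * u r                                                             ≈⟨ *-identityˡ _ ⟩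
    u r                                                                  ∎

  Eg-surjective : ∀ {g} → Surjective (blockDiag (Eg {g}))
  Eg-surjective u = (λ r → (if lastBit (proj₂ r) then - iR else 1#) * u r) ,
    λ (s , a) → trans (act-diagonal (λ a → if lastBit a then iR else 1#) _ s a) (cancel (lastBit a) (u (s , a)))
    where
      cancel : ∀ b x → (if b then iR else 1#) * ((if b then - iR else 1#) * x) ≈ x
      cancel true x = trans (sym (*-assoc _ _ _)) (trans (*-congʳ i*-i≈1) (*-identityˡ x))
      cancel false x = trans (*-identityˡ _) (*-identityˡ x)

  Mσ-surjective : ∀ {g} w (M : Vec (Vec Bool g) g) → IsInvertible M → Surjective (blockDiag (Mσ w M))
  Mσ-surjective w M (N , NM , MN) u = (λ (s , a) → u (s , affine N w′ a)) ,
    λ (s , a) → trans (act-Mσ w M _ s a) (reflexive (≡.cong (λ b → u (s , b)) (affine-inverseˡ a)))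
    where open AffineInverse NM MN w

  ηM-surjective : ∀ {g} → Surjective (ηM {g})
  ηM-surjective u = (λ r → ζ ^ 7 * u r) , λ r → begin
    act ηM (λ r → ζ ^ 7 * u r) r    ≈⟨ act-scalar ζ _ r ⟩
    ζ * (ζ ^ 7 * u r)               ≈⟨ *-assoc _ _ _ ⟨
    ζ ^ 8 * u r                     ≈⟨ *-congʳ ζ^8≈1 ⟩
    1# * u r                        ≈⟨ *-identityˡ _ ⟩
    u r                             ∎
    where
      ζ^8≈1 : ζ ^ 8 ≈ 1#
      ζ^8≈1 = trans (sym (^-assocʳ ζ 4 2)) (trans (^-congˡ 2 ζ^4≈-1) (trans (*-congˡ (*-identityʳ _)) -1*-1≈1))

  idM-surjective : ∀ {g} → Surjective (idM {g})
  idM-surjective u = u , act-idM u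

  powR-+ : ∀ x a b → powR x (a ℕ.+ b) ≈ powR x a * powR x b
  powR-+ x a b = begin
    powR x (a ℕ.+ b)       ≡⟨ powR≡^ x (a ℕ.+ b) ⟩
    x ^ (a ℕ.+ b)          ≈⟨ ^-homo-* x a b ⟩
    x ^ a * x ^ b          ≡⟨ ≡.cong₂ _*_ (powR≡^ x a) (powR≡^ x b) ⟨
    powR x a * powR x b    ∎

  module CodeInvariance {n : ℕ} {C : Code n} (typeII : IsTypeII C) (T : Vec Bool n) (g : ℕ) where
    open TypeII typeII
    open SelfDualSums R 2-torsion-free (proj₁ typeII)
    open TypeIIGauss typeII
    open TupleMembership typeII

    monomial : Point g → Vec (Vec Bool n) g → Carrier
    monomial v us = ∏.fold (List.allFin n) (λ i → v (lookup T i , column us i))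

    J : Point g → Carrier
    J v = ∑.fold (allTuples g n) (λ us → if allIn C us then monomial v us else 0#)

    jacobi≈J : ∀ v → jacobi g C T v ≈ J v
    jacobi≈J v = ∑.fold-cong (allTuples g n) (λ us → if-cong (allIn C us) (exponents-as-product us (List.allFin n)))
      where
        module _ (us : Vec (Vec Bool n) g) where
          inT inF : Vec Bool g → Fin n → ℕ
          inT a i = if lookup T i ∧ eqV (column us i) a then 1 else 0
          inF a i = if lookup (Vec.map not T) i ∧ eqV (column us i) a then 1 else 0

          one-coordinate : ∀ t e y x → powR y (if t ∧ e then 1 else 0) * powR x (if not t ∧ e then 1 else 0)
                                       ≈ (if e then (if t then y else x) else 1#)
          one-coordinate true true y x = trans (*-identityʳ _) (*-identityʳ _)
          one-coordinate true false y x = *-identityʳ _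
          one-coordinate false true y x = trans (*-identityˡ _) (*-identityʳ _)
          one-coordinate false false y x = *-identityʳ _

          select : ∀ t a → (if t then v (true , a) else v (false , a)) ≡ v (t , a)
          select true a = ≡.refl
          select false a = ≡.refl

          coordinate : ∀ j → ∏.fold (allVecs g) (λ a → powR (v (true , a)) (inT a j) * powR (v (false , a)) (inF a j))
                              ≈ v (lookup T j , column us j)
          coordinate j = begin
            ∏.fold (allVecs g) (λ a → powR (v (true , a)) (inT a j) * powR (v (false , a)) (inF a j))
              ≈⟨ ∏.fold-cong (allVecs g) (λ a → trans
                   (reflexive (≡.cong (λ t → powR (v (true , a)) (inT a j) * powR (v (false , a)) (if t ∧ eqV (column us j) a then 1 else 0))
                                      (Vec.lookup-map j not T)))
                   (one-coordinate (lookup T j) (eqV (column us j) a) _ _)) ⟩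
            ∏.fold (allVecs g) (λ a → if eqV (column us j) a then (if lookup T j then v (true , a) else v (false , a)) else 1#)
              ≈⟨ ∏.allVecs-sifts g (column us j) _ ⟩
            (if lookup T j then v (true , column us j) else v (false , column us j))
              ≡⟨ select (lookup T j) (column us j) ⟩
            v (lookup T j , column us j) ∎

          exponents-as-product : ∀ (L : List (Fin n)) →
            ∏.fold (allVecs g) (λ a → powR (v (true , a)) (sum (List.map (inT a) L)) * powR (v (false , a)) (sum (List.map (inF a) L)))
            ≈ ∏.fold L (λ i → v (lookup T i , column us i))
          exponents-as-product [] = trans (∏.fold-cong (allVecs g) (λ a → *-identityˡ _)) (∏.fold-ε (allVecs g))
          exponents-as-product (j ∷ L) = trans
            (∏.fold-cong (allVecs g) (λ a → trans (*-cong (powR-+ _ (inT a j) _) (powR-+ _ (inF a j) _)) (interchange _ _ _ _)))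
            (trans (∏.fold-∙ (allVecs g) _ _) (*-cong (coordinate j) (exponents-as-product L)))
            where open CommutativeSemigroupProperties *-commutativeSemigroup using (interchange)

    J-cong : ∀ {v w : Point g} → (∀ r → v r ≈ w r) → J v ≈ J w
    J-cong v≈w = ∑.fold-cong (allTuples g n) (λ us → if-cong (allIn C us) (∏.fold-cong (List.allFin n) (λ i → v≈w _)))

    J-scaling : (e : Vec Bool g → Carrier) →
                (∀ us → allIn C us ≡ true → ∏.fold (List.allFin n) (λ i → e (column us i)) ≈ 1#) →
                ∀ v → J (λ r → e (proj₂ r) * v r) ≈ J v
    J-scaling e trivial-on-C v = ∑.fold-cong (allTuples g n) (λ us → scaled-term us (allIn C us) ≡.refl)
      where
        scaled-term : ∀ us b → allIn C us ≡ b →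
                      (if b then monomial (λ r → e (proj₂ r) * v r) us else 0#) ≈ (if b then monomial v us else 0#)
        scaled-term us true us∈C = begin
          monomial (λ r → e (proj₂ r) * v r) us                                    ≈⟨ ∏.fold-∙ (List.allFin n) _ _ ⟩
          ∏.fold (List.allFin n) (λ i → e (column us i)) * monomial v us           ≈⟨ *-congʳ (trivial-on-C us us∈C) ⟩
          1# * monomial v us                                                       ≈⟨ *-identityˡ _ ⟩
          monomial v us                                                            ∎
        scaled-term us false _ = refl

    Invariant : Matrix g → Set (c ⊔ ℓ)
    Invariant τ = ∀ v → J (act τ v) ≈ J v

    ηM-invariant : Invariant ηM
    ηM-invariant v = trans (J-cong (act-scalar ζ v)) (J-scaling (λ _ → ζ) (λ _ _ → trans (∏-const n ζ) ζ^n≈1) v)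

    Eg-invariant : Invariant (blockDiag Eg)
    Eg-invariant v = trans (J-cong (λ r → act-diagonal e v (proj₁ r) (proj₂ r))) (J-scaling e trivial-on-C v)
      where
        e : Vec Bool g → Carrier
        e a = if lastBit a then iR else 1#
        trivial-on-C : ∀ us → allIn C us ≡ true → ∏.fold (List.allFin n) (λ i → e (column us i)) ≈ 1#
        trivial-on-C us us∈C = begin
          ∏.fold (List.allFin n) (λ i → e (column us i))
            ≈⟨ ∏.fold-cong (List.allFin n) (λ i → reflexive (≡.cong (λ b → if b then iR else 1#) (lastBit-column us i))) ⟩
          ∏.fold (List.allFin n) (λ i → if lookup (lastRow us) i then iR else 1#)
            ≈⟨ ∏-iWeight (lastRow us) ⟩
          iWeight (lastRow us)
            ≈⟨ iWeight≈1 (lastRow us) (proj₂ typeII _ (lastRow∈C us us∈C)) ⟩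
          1# ∎

    Mσ-invariant : ∀ w M → IsInvertible M → Invariant (blockDiag (Mσ w M))
    Mσ-invariant w M (N , NM , MN) v = begin
      J (act (blockDiag (Mσ w M)) v)
        ≈⟨ J-cong (λ r → act-Mσ w M v (proj₁ r) (proj₂ r)) ⟩
      J (λ r → v (proj₁ r , affine M w (proj₂ r)))
        ≈⟨ ∑.fold-cong (allTuples g n) transformed ⟩
      ∑.fold (allTuples g n) (λ us → term (affineTuple M w us))
        ≈⟨ ∑.fold-allTuples-bijection g n (affineTuple M w) (affineTuple N w′) affineTuple-inverseˡ affineTuple-inverseʳ term ⟩
      J v ∎
      where
        open AffineInverse NM MN w
        term : Vec (Vec Bool n) g → Carrier
        term us = if allIn C us then monomial v us else 0#
        transformed : ∀ us → (if allIn C us then monomial (λ r → v (proj₁ r , affine M w (proj₂ r))) us else 0#)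
                             ≈ term (affineTuple M w us)
        transformed us = trans
          (if-cong (allIn C us) (∏.fold-cong (List.allFin n) (λ i →
             reflexive (≡.cong (λ a → v (lookup T i , a)) (≡.sym (column-affineTuple M w us i))))))
          (reflexive (≡.cong (λ b → if b then monomial v (affineTuple M w us) else 0#) (≡.sym (allIn-affineTuple NM MN w us))))

    Tg-point : Point g → Point g
    Tg-point v (s , a) = ∑.fold (allVecs g) (λ b → (κ ^ g * χ (dot a b)) * v (s , b))

    monomial-Tg-point : ∀ v us →
      monomial (Tg-point v) us ≈ ∑.fold (allTuples g n) (λ ws → ((κ ^ g) ^ n * χ (tupleDot us ws)) * monomial v ws)
    monomial-Tg-point v us = begin
      monomial (Tg-point v) us
        ≈⟨ ∏∑≈∑∏ g n (λ i b → (κ ^ g * χ (dot (column us i) b)) * v (lookup T i , b)) ⟩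
      ∑.fold (allTuples g n) (λ ws → ∏.fold (List.allFin n) (λ i →
        (κ ^ g * χ (dot (column us i) (column ws i))) * v (lookup T i , column ws i)))
        ≈⟨ ∑.fold-cong (allTuples g n) (λ ws → trans (∏.fold-∙ (List.allFin n) _ _)
             (*-congʳ (trans (∏.fold-∙ (List.allFin n) _ _) (*-cong (∏-const n (κ ^ g)) (∏χ-columns≈χ-tupleDot g n us ws))))) ⟩
      ∑.fold (allTuples g n) (λ ws → ((κ ^ g) ^ n * χ (tupleDot us ws)) * monomial v ws) ∎

    [κ^g]^n*card^g≈1 : (κ ^ g) ^ n * card C ^ g ≈ 1#
    [κ^g]^n*card^g≈1 = begin
      (κ ^ g) ^ n * card C ^ g    ≈⟨ *-congʳ (^-assocʳ κ g n) ⟩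
      κ ^ (g ℕ.* n) * card C ^ g  ≡⟨ ≡.cong (λ k → κ ^ k * card C ^ g) (ℕ.*-comm g n) ⟩
      κ ^ (n ℕ.* g) * card C ^ g  ≈⟨ *-congʳ (^-assocʳ κ n g) ⟨
      (κ ^ n) ^ g * card C ^ g    ≈⟨ ^-inverse κ^n*card≈1 g ⟩
      1#                          ∎

    -- A MacWilliams transform: after expanding each monomial, the sum over C^g of the
    -- characters χ (tupleDot us ws) is card C ^ g on C^g and 0 off it.
    Tg-invariant : Invariant (blockDiag Tg)
    Tg-invariant v = begin
      J (act (blockDiag Tg) v)
        ≈⟨ J-cong (λ (s , a) → trans (act-blockDiag Tg v s a)
             (∑.fold-cong (allVecs g) (λ b → *-congʳ (*-congʳ (reflexive (powR≡^ κ g)))))) ⟩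
      J (Tg-point v)
        ≈⟨ ∑.fold-cong Tuples (λ us → if-cong (allIn C us) (monomial-Tg-point v us)) ⟩
      ∑.fold Tuples (λ us → if allIn C us then ∑.fold Tuples (λ ws → (κ^gn * χ (tupleDot us ws)) * monomial v ws) else 0#)
        ≈⟨ ∑.fold-cong Tuples (λ us → sym (∑.fold-if Tuples (allIn C us) _)) ⟩
      ∑.fold Tuples (λ us → ∑.fold Tuples (λ ws → if allIn C us then (κ^gn * χ (tupleDot us ws)) * monomial v ws else 0#))
        ≈⟨ ∑.fold-swap Tuples Tuples _ ⟩
      ∑.fold Tuples (λ ws → ∑.fold Tuples (λ us → if allIn C us then (κ^gn * χ (tupleDot us ws)) * monomial v ws else 0#))
        ≈⟨ ∑.fold-cong Tuples (λ ws → ∑.fold-cong Tuples (λ us → rearrange (allIn C us) us ws)) ⟩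
      ∑.fold Tuples (λ ws → ∑.fold Tuples (λ us → (if allIn C us then χ (tupleDot us ws) else 0#) * (κ^gn * monomial v ws)))
        ≈⟨ ∑.fold-cong Tuples (λ ws → sym (∑-*ʳ Tuples _ _)) ⟩
      ∑.fold Tuples (λ ws → ∑.fold Tuples (λ us → if allIn C us then χ (tupleDot us ws) else 0#) * (κ^gn * monomial v ws))
        ≈⟨ ∑.fold-cong Tuples (λ ws → *-congʳ (tupleCharacter-sum g ws)) ⟩
      ∑.fold Tuples (λ ws → (if allIn C ws then card C ^ g else 0#) * (κ^gn * monomial v ws))
        ≈⟨ ∑.fold-cong Tuples (λ ws → normalise (allIn C ws) ws) ⟩
      J v ∎
      where
        Tuples = allTuples g n
        κ^gn = (κ ^ g) ^ n

        rearrange : ∀ b us ws → (if b then (κ^gn * χ (tupleDot us ws)) * monomial v ws else 0#)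
                                ≈ (if b then χ (tupleDot us ws) else 0#) * (κ^gn * monomial v ws)
        rearrange true us ws = solve 3 (λ x y z → (x ⊕ y) ⊕ z ⊜ y ⊕ (x ⊕ z)) refl κ^gn (χ (tupleDot us ws)) (monomial v ws)
        rearrange false us ws = sym (zeroˡ _)

        normalise : ∀ b ws → (if b then card C ^ g else 0#) * (κ^gn * monomial v ws) ≈ (if b then monomial v ws else 0#)
        normalise true ws = trans (sym (*-assoc _ _ _)) (trans (*-congʳ (trans (*-comm _ _) [κ^g]^n*card^g≈1)) (*-identityˡ _))
        normalise false ws = zeroˡ _

    idM-invariant : Invariant idM
    idM-invariant v = J-cong (act-idM v)

    InvariantSurjective : Matrix g → Set (c ⊔ ℓ)
    InvariantSurjective τ = Invariant τ × Surjective τ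

    ·ₘ-invariantSurjective : ∀ {A B} → InvariantSurjective A → InvariantSurjective B → InvariantSurjective (A ·ₘ B)
    ·ₘ-invariantSurjective {A} {B} (A-inv , A-surj) (B-inv , B-surj) = AB-inv , AB-surj
      where
        AB-inv : Invariant (A ·ₘ B)
        AB-inv v = trans (J-cong (act-·ₘ A B v)) (trans (A-inv (act B v)) (B-inv v))
        AB-surj : Surjective (A ·ₘ B)
        AB-surj u with A-surj u
        ... | w , Aw≈u with B-surj w
        ...   | w′ , Bw′≈w = w′ , λ r → trans (act-·ₘ A B w′ r) (trans (act-congʳ A Bw′≈w r) (Aw≈u r))

    -- A left inverse of a surjective action is also a right inverse, so it inherits invariance.
    leftInverse-invariantSurjective : ∀ {A B} → InvariantSurjective A → (∀ r s → (B ·ₘ A) r s ≈ idM r s) → InvariantSurjective B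
    leftInverse-invariantSurjective {A} {B} (A-inv , A-surj) BA≈id = B-inv , λ u → act A u , BA u
      where
        BA : ∀ w r → act B (act A w) r ≈ w r
        BA w r = trans (sym (act-·ₘ B A w r)) (trans (act-congˡ BA≈id w r) (act-idM w r))
        B-inv : Invariant B
        B-inv v with A-surj v
        ... | w , Aw≈v = begin
          J (act B v)           ≈⟨ J-cong (act-congʳ B (λ r → sym (Aw≈v r))) ⟩
          J (act B (act A w))   ≈⟨ J-cong (BA w) ⟩
          J w                   ≈⟨ A-inv w ⟨
          J (act A w)           ≈⟨ J-cong Aw≈v ⟩
          J v                   ∎

    ≈-invariantSurjective : ∀ {A B} → InvariantSurjective A → (∀ r s → A r s ≈ B r s) → InvariantSurjective B
    ≈-invariantSurjective {A} {B} (A-inv , A-surj) A≈B =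
      (λ v → trans (J-cong (λ r → sym (act-congˡ A≈B v r))) (A-inv v)) ,
      λ u → proj₁ (A-surj u) , λ r → trans (sym (act-congˡ A≈B _ r)) (proj₂ (A-surj u) r)

    InG⇒invariantSurjective : ∀ {τ} → InG g τ → InvariantSurjective τ
    InG⇒invariantSurjective genT = Tg-invariant , Tg-surjective
    InG⇒invariantSurjective genE = Eg-invariant , Eg-surjective
    InG⇒invariantSurjective (genM w M M-inv) = Mσ-invariant w M M-inv , Mσ-surjective w M M-inv
    InG⇒invariantSurjective genη = ηM-invariant , ηM-surjective
    InG⇒invariantSurjective one = idM-invariant , idM-surjective
    InG⇒invariantSurjective (mul A∈G B∈G) =
      ·ₘ-invariantSurjective (InG⇒invariantSurjective A∈G) (InG⇒invariantSurjective B∈G)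
    InG⇒invariantSurjective (inv A∈G BA≈id) = leftInverse-invariantSurjective (InG⇒invariantSurjective A∈G) BA≈id
    InG⇒invariantSurjective (resp A∈G A≈B) = ≈-invariantSurjective (InG⇒invariantSurjective A∈G) A≈B

    jacobi-invariant : ∀ {τ} → InG g τ → ∀ v → jacobi g C T (act τ v) ≈ jacobi g C T v
    jacobi-invariant {τ} τ∈G v = begin
      jacobi g C T (act τ v)   ≈⟨ jacobi≈J (act τ v) ⟩
      J (act τ v)              ≈⟨ proj₁ (InG⇒invariantSurjective τ∈G) v ⟩
      J v                      ≈⟨ jacobi≈J v ⟨
      jacobi g C T v           ∎


theorem5p4 : ∀ {c ℓ : Level} (R : CommutativeRing c ℓ)
  (ζ half : CommutativeRing.Carrier R) →
  let open CommutativeRing R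
      open Over R ζ half
  in (ζ * ζ * ζ * ζ ≈ - 1#) → ((1# + 1#) * half ≈ 1#) →
     (g : ℕ) → 1 ≤ g → (n : ℕ) (C : Code n) → IsTypeII C → (T : Vec Bool n) →
     (τ : Matrix g) → InG g τ →
     (v : Point g) → jacobi g C T (act τ v) ≈ jacobi g C T v
theorem5p4 R ζ half ζ⁴≈-1 two*half≈1 g _ n C typeII T τ τ∈G =
  CodeInvariance.jacobi-invariant typeII T g τ∈G
  where open Invariance R ζ half ζ⁴≈-1 two*half≈1
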